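{- Let $\phi$ be a stratified formula, let $t$ and $r$ be stratified terms, and let $b\in\mathbb{A}_{\mathrm{level}(t)}$. Then $[\![\phi]\!][b\mapsto[\![t]\!]]=[\![\phi[b:=t]]\!]$ and $[\![r]\!][b\mapsto[\![t]\!]]=[\![r[b:=t]]\!]$.
   Context: Atoms: for each $i\in\mathbb{Z}$ fix a countably infinite set $\mathbb{A}_i$ of atoms, pairwise disjoint, $\mathbb{A}=\bigcup_i\mathbb{A}_i$, $\mathrm{level}(a)=i$ iff $a\in\mathbb{A}_i$. Permutations are finitely-supported level-preserving bijections of $\mathbb{A}$; $\mathrm{supp}(x)$ is the least finite set of atoms such that every permutation fixing it pointwise fixes $x$, and $a\#x$ means $a\notin\mathrm{supp}(x)$. $[a]X$ is nominal atoms-abstraction (binding $a$ in $X$): $[a]X=[b]((b\ a)\cdot X)$ when $b\#X$. Internal syntax: $\mathsf{Pred}$ and $\mathsf{Set}_i$ ($i\in\mathbb{Z}$) are defined inductively: $\mathsf{atm}(a)\in\mathsf{Set}_i$ for $a\in\mathbb{A}_i$; $\mathsf{and}(\mathcal X)\in\mathsf{Pred}$ for finite $\mathcal X\subseteq\mathsf{Pred}$; $\mathsf{neg}(X)$; $\mathsf{all}([a]X)$ for $a\in\mathbb{A}$; $\mathsf{elt}(x,a)\in\mathsf{Pred}$ for $a\in\mathbb{A}_{i+1}$, $x\in\mathsf{Set}_i$; $\mathsf{st}([a]X)\in\mathsf{Set}_i$ for $a\in\mathbb{A}_{i-1}$, $X\in\mathsf{Pred}$ (an internal comprehension). For an internal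 comprehension $x\in\mathsf{Set}_i$ and $c\in\mathbb{A}_{i-1}$ with $c\#x$, $x@c$ is the unique $X$ with $x=\mathsf{st}([c]X)$. Sigma-action: for $a\in\mathbb{A}_i$, $x\in\mathsf{Set}_i$, the well-defined operation $Z[a\mapsto x]$, $z[a\mapsto x]$ is given by (with $b,c$ atoms distinct from $a$): $\mathsf{and}(\mathcal X)[a\mapsto x]=\mathsf{and}(\{X[a\mapsto x]\mid X\in\mathcal X\})$; $\mathsf{neg}(X)[a\mapsto x]=\mathsf{neg}(X[a\mapsto x])$; $\mathsf{all}([b]X)[a\mapsto x]=\mathsf{all}([b](X[a\mapsto x]))$ if $b\#x$; $\mathsf{elt}(y,a)[a\mapsto\mathsf{atm}(n)]=\mathsf{elt}(y[a\mapsto\mathsf{atm}(n)],n)$ for any $n\in\mathbb{A}_i$; $\mathsf{elt}(y,a)[a\mapsto\mathsf{st}([a']X')]=X'[a'\mapsto y[a\mapsto\mathsf{st}([a']X')]]$ for fresh $a'\in\mathbb{A}_{i-1}$; $\mathsf{elt}(y,b)[a\mapsto x]=\mathsf{elt}(y[a\mapsto x],b)$; $\mathsf{atm}(a)[a\mapsto x]=x$; $\mathsf{atm}(b)[a\mapsto x]=\mathsf{atm}(b)$; $\mathsf{st}([c]X)[a\mapsto x]=\mathsf{st}([c](X[a\mapsto x]))$ if $c\#x$. For $x\in\mathsf{Set}_i$, $y\in\mathsf{Set}_{i-1}$: $y\mathbin{\tilde\in}x=(x@b)[b\mapsto y]$ for fresh $b\in\mathbb{A}_{i-1}$ if $x$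 is a comprehension, and $y\mathbin{\tilde\in}\mathsf{atm}(a)=\mathsf{elt}(y,a)$. Stratified Sets: formulae $\phi::=\bot\mid\neg\phi\mid\phi\wedge\phi\mid\forall a.\phi\mid s\in t$, terms $s::=a\mid\{a\mid\phi\}$, up to $\alpha$-equivalence, with capture-avoiding substitution $\phi[a:=s]$; $\mathrm{level}(\{a\mid\phi\})=\mathrm{level}(a)+1$; stratified means every subformula $s'\in s$ has $\mathrm{level}(s)=\mathrm{level}(s')+1$. Interpretation: $[\![\bot]\!]=\mathsf{neg}(\mathsf{and}(\varnothing))$, $[\![\neg\phi]\!]=\mathsf{neg}([\![\phi]\!])$, $[\![\phi\wedge\psi]\!]=\mathsf{and}(\{[\![\phi]\!],[\![\psi]\!]\})$, $[\![\forall a.\phi]\!]=\mathsf{all}([a][\![\phi]\!])$, $[\![t\in s]\!]=[\![t]\!]\mathbin{\tilde\in}[\![s]\!]$, $[\![\{a\mid\phi\}]\!]=\mathsf{st}([a][\![\phi]\!])$, $[\![a]\!]=\mathsf{atm}(a)$; a stratified term of level $i$ is mapped into $\mathsf{Set}_i$. -}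

module Defs where

open import Data.Nat as ℕ using (ℕ; zero; suc)
open import Data.Integer as ℤ using (ℤ; +_)
open import Data.Product using (_×_; _,_; proj₁; proj₂; Σ; ∃-syntax)
open import Data.Product.Properties using (≡-dec)
open import Data.List using (List; []; _∷_; _++_; lookup)
open import Data.List.Membership.Propositional using (_∉_)
open import Data.Maybe using (Maybe; just; nothing)
open import Data.Unit using (⊤)
open import Data.Bool using (true; false)
open import Relation.Binary.PropositionalEquality using (_≡_; _≢_)
open import Relation.Nullary using (Dec; yes; no)

-- Atoms.  An atom is a pair (level , index); 𝔸ᵢ = { (i , n) | n : ℕ }
-- is countably infinite, and the 𝔸ᵢ are pairwise disjoint.

Atom : Set
Atom = ℤ × ℕ

level : Atom → ℤ
level = proj₁

_≟A_ : (a b : Atom) → Dec (a ≡ b)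
_≟A_ = ≡-dec ℤ._≟_ ℕ._≟_

-- Variables of a locally nameless syntax: free atoms, or bound
-- (de Bruijn) indices pointing at an enclosing atoms-abstraction.
data Vr : Set where
  fr : Atom → Vr
  bd : ℕ → Vr

-- Internal syntax Pred / Set (locally nameless rendering of the nominal
-- datatype; binders record the level of the bound atom).
--   and (finite set of predicates, given as a list), neg, all([a]X),
--   elt(x,a), atm(a), st([a]X).

mutual
  data Pr : Set where
    and : List Pr → Pr
    neg : Pr → Pr
    all : ℤ → Pr → Pr          -- all i X  =  all([a]X) with a ∈ 𝔸ᵢ bound
    elt : St → Vr → Pr

  data St : Set where
    atm : Vr → St
    st  : ℤ → Pr → St          -- st j X  =  st([a]X) with a ∈ 𝔸ⱼ bound

mutual
  openV : ℕ → Atom → Vr → Vr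
  openV k c (fr a) = fr a
  openV k c (bd n) with k ℕ.≟ n
  ... | yes _ = fr c
  ... | no  _ = bd n

  openP : ℕ → Atom → Pr → Pr
  openP k c (and Xs) = and (openL k c Xs)
  openP k c (neg X) = neg (openP k c X)
  openP k c (all i X) = all i (openP (suc k) c X)
  openP k c (elt x v) = elt (openS k c x) (openV k c v)

  openL : ℕ → Atom → List Pr → List Pr
  openL k c [] = []
  openL k c (X ∷ Xs) = openP k c X ∷ openL k c Xs

  openS : ℕ → Atom → St → St
  openS k c (atm v) = atm (openV k c v)
  openS k c (st j X) = st j (openP (suc k) c X)

mutual
  closeV : ℕ → Atom → Vr → Vr
  closeV k c (fr a) with a ≟A c
  ... | yes _ = bd k
  ... | no  _ = fr a
  closeV k c (bd n) = bd n

  closeP : ℕ → Atom → Pr → Pr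
  closeP k c (and Xs) = and (closeL k c Xs)
  closeP k c (neg X) = neg (closeP k c X)
  closeP k c (all i X) = all i (closeP (suc k) c X)
  closeP k c (elt x v) = elt (closeS k c x) (closeV k c v)

  closeL : ℕ → Atom → List Pr → List Pr
  closeL k c [] = []
  closeL k c (X ∷ Xs) = closeP k c X ∷ closeL k c Xs

  closeS : ℕ → Atom → St → St
  closeS k c (atm v) = atm (closeV k c v)
  closeS k c (st j X) = st j (closeP (suc k) c X)

atomsV : Vr → List Atom
atomsV (fr a) = a ∷ []
atomsV (bd _) = []

mutual
  atomsP : Pr → List Atom
  atomsP (and Xs) = atomsL Xs
  atomsP (neg X) = atomsP X
  atomsP (all i X) = atomsP X
  atomsP (elt x v) = atomsS x ++ atomsV v

  atomsL : List Pr → List Atom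
  atomsL [] = []
  atomsL (X ∷ Xs) = atomsP X ++ atomsL Xs

  atomsS : St → List Atom
  atomsS (atm v) = atomsV v
  atomsS (st j X) = atomsP X

-- The sigma-action Z[a ↦ x], given by its graph: the least relation
-- closed under the defining clauses of the paper.
--   SigP Z a x W   means   Z[a ↦ x] = W   (Z ∈ Pred)
--   SigS z a x w   means   z[a ↦ x] = w   (z ∈ Set)

mutual
  data SigP : Pr → Atom → St → Pr → Set where
    sig-and : ∀ {Xs a x Ys} → SigL Xs a x Ys → SigP (and Xs) a x (and Ys)
    sig-neg : ∀ {X a x Y} → SigP X a x Y → SigP (neg X) a x (neg Y)
    sig-all : ∀ {i X a x W} (b : Atom) → level b ≡ i → b ≢ a →
              b ∉ atomsP X → b ∉ atomsS x →
              SigP (openP 0 b X) a x W →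
              SigP (all i X) a x (all i (closeP 0 b W))
    sig-elt-atm : ∀ {y a n y'} → SigS y a (atm (fr n)) y' →
                  SigP (elt y (fr a)) a (atm (fr n)) (elt y' (fr n))
    -- elt(y,a)[a↦st([a']X')] = X'[a' ↦ y[a↦st([a']X')]]   for fresh a'
    sig-elt-st : ∀ {y a j X' Y W} (a' : Atom) → level a' ≡ j → a' ≢ a →
                 a' ∉ atomsP X' → a' ∉ atomsS y →
                 SigS y a (st j X') Y →
                 SigP (openP 0 a' X') a' Y W →
                 SigP (elt y (fr a)) a (st j X') W
    sig-elt-oth : ∀ {y b a x y'} → b ≢ a → SigS y a x y' →
                  SigP (elt y (fr b)) a x (elt y' (fr b))

  data SigL : List Pr → Atom → St → List Pr → Set where
    sigL-[] : ∀ {a x} → SigL [] a x []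
    sigL-∷  : ∀ {X Xs a x Y Ys} → SigP X a x Y → SigL Xs a x Ys →
              SigL (X ∷ Xs) a x (Y ∷ Ys)

  data SigS : St → Atom → St → St → Set where
    sig-atm-eq  : ∀ {a x} → SigS (atm (fr a)) a x x
    sig-atm-neq : ∀ {b a x} → b ≢ a → SigS (atm (fr b)) a x (atm (fr b))
    sig-st : ∀ {j X a x W} (c : Atom) → level c ≡ j → c ≢ a →
             c ∉ atomsP X → c ∉ atomsS x →
             SigP (openP 0 c X) a x W →
             SigS (st j X) a x (st j (closeP 0 c W))

-- y ∈̃ x  (graph):  Memb y x W  means  y ∈̃ x = W
data Memb : St → St → Pr → Set where
  memb-atm : ∀ {y a} → Memb y (atm (fr a)) (elt y (fr a))
  -- y ∈̃ x = (x@b)[b ↦ y] for fresh b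
  memb-st  : ∀ {y j X W} (b : Atom) → level b ≡ j →
             b ∉ atomsP X → b ∉ atomsS y →
             SigP (openP 0 b X) b y W → Memb y (st j X) W

mutual
  data Fm : Set where
    ⊥f   : Fm
    ¬f   : Fm → Fm
    _∧f_ : Fm → Fm → Fm
    ∀f   : ℤ → Fm → Fm          -- ∀f i φ = ∀a.φ with a ∈ 𝔸ᵢ bound
    _∈f_ : Tm → Tm → Fm

  data Tm : Set where
    var : Vr → Tm
    cmp : ℤ → Fm → Tm           -- cmp j φ = {a | φ} with a ∈ 𝔸ⱼ bound

mutual
  openF : ℕ → Atom → Fm → Fm
  openF k c ⊥f = ⊥f
  openF k c (¬f φ) = ¬f (openF k c φ)
  openF k c (φ ∧f ψ) = openF k c φ ∧f openF k c ψ
  openF k c (∀f i φ) = ∀f i (openF (suc k) c φ)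
  openF k c (s ∈f t) = openT k c s ∈f openT k c t

  openT : ℕ → Atom → Tm → Tm
  openT k c (var v) = var (openV k c v)
  openT k c (cmp j φ) = cmp j (openF (suc k) c φ)

mutual
  atomsF : Fm → List Atom
  atomsF ⊥f = []
  atomsF (¬f φ) = atomsF φ
  atomsF (φ ∧f ψ) = atomsF φ ++ atomsF ψ
  atomsF (∀f i φ) = atomsF φ
  atomsF (s ∈f t) = atomsT s ++ atomsT t

  atomsT : Tm → List Atom
  atomsT (var v) = atomsV v
  atomsT (cmp j φ) = atomsF φ

-- capture-avoiding substitution φ[b := s] (s locally closed, so no
-- capture can occur in the locally nameless representation)
substV : Atom → Tm → Vr → Tm
substV b s (fr a) with a ≟A b
... | yes _ = s
... | no  _ = var (fr a)
substV b s (bd n) = var (bd n)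

mutual
  substF : Atom → Tm → Fm → Fm
  substF b s ⊥f = ⊥f
  substF b s (¬f φ) = ¬f (substF b s φ)
  substF b s (φ ∧f ψ) = substF b s φ ∧f substF b s ψ
  substF b s (∀f i φ) = ∀f i (substF b s φ)
  substF b s (u ∈f t) = substT b s u ∈f substT b s t

  substT : Atom → Tm → Tm → Tm
  substT b s (var v) = substV b s v
  substT b s (cmp j φ) = cmp j (substF b s φ)

-- levels, relative to a context Γ listing the levels of the enclosing
-- binders (innermost first); nothing for an unbound index
lvV : List ℤ → Vr → Maybe ℤ
lvV Γ (fr a) = just (level a)
lvV [] (bd n) = nothing
lvV (i ∷ Γ) (bd zero) = just i
lvV (i ∷ Γ) (bd (suc n)) = lvV Γ (bd n)

lvT : List ℤ → Tm → Maybe ℤ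
lvT Γ (var v) = lvV Γ v
lvT Γ (cmp j φ) = just (j ℤ.+ + 1)

-- stratification (also enforces that all bound indices are in scope)
mutual
  StratF : List ℤ → Fm → Set
  StratF Γ ⊥f = ⊤
  StratF Γ (¬f φ) = StratF Γ φ
  StratF Γ (φ ∧f ψ) = StratF Γ φ × StratF Γ ψ
  StratF Γ (∀f i φ) = StratF (i ∷ Γ) φ
  StratF Γ (s' ∈f s) = StratT Γ s' × StratT Γ s ×
                       (∃[ j ] (lvT Γ s' ≡ just j × lvT Γ s ≡ just (j ℤ.+ + 1)))

  StratT : List ℤ → Tm → Set
  StratT Γ (var v) = ∃[ i ] (lvV Γ v ≡ just i)
  StratT Γ (cmp j φ) = StratF (j ∷ Γ) φ

Stratified : Fm → Set
Stratified = StratF []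

StratifiedT : Tm → Set
StratifiedT = StratT []

-- The interpretation ⟦-⟧ (graph), on locally closed formulae/terms.
--   IntF φ X  means ⟦φ⟧ = X ;  IntT s x  means ⟦s⟧ = x

mutual
  data IntF : Fm → Pr → Set where
    int-⊥ : IntF ⊥f (neg (and []))
    int-¬ : ∀ {φ X} → IntF φ X → IntF (¬f φ) (neg X)
    int-∧ : ∀ {φ ψ X Y} → IntF φ X → IntF ψ Y → IntF (φ ∧f ψ) (and (X ∷ Y ∷ []))
    int-∀ : ∀ {i φ X} (a : Atom) → level a ≡ i → a ∉ atomsF φ →
            IntF (openF 0 a φ) X → IntF (∀f i φ) (all i (closeP 0 a X))
    int-∈ : ∀ {t s y x W} → IntT t y → IntT s x → Memb y x W → IntF (t ∈f s) W

  data IntT : Tm → St → Set where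
    int-var : ∀ {a} → IntT (var (fr a)) (atm (fr a))
    int-cmp : ∀ {j φ X} (a : Atom) → level a ≡ j → a ∉ atomsF φ →
              IntF (openF 0 a φ) X → IntT (cmp j φ) (st j (closeP 0 a X))

module Submission where

-- The σ-action, ∈̃ and ⟦-⟧ are given in Defs as graphs whose binder clauses pick SOME fresh atom,
-- so the proof has three layers.
--  1. Nominal bookkeeping for the locally nameless syntax.  Swapping two atoms of equal level is an
--     automorphism of every graph (equivariance); hence the fresh atom of any binder clause can be
--     re-chosen at will ("renaming" lemmas).
--  2. The σ-action on well-typed internal syntax (all levels ≥ a floor m): it preserves typing, is
--     total and deterministic (induction on the rank level(a) - m, then on size), is the identity
--     when a # Z, and satisfies the commutation law
--        Z[c↦y][b↦T] = Z[b↦T][c↦y[b↦T]]      (c ≠ b, c # T)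
--     by induction on rank(b) + rank(c), then size.  All clauses are structural except  t' ∈ {a | ψ}, where
--     ⟦t' ∈ {a|ψ}⟧ = ⟦ψ⟧[a ↦ ⟦t'⟧] and the commutation law moves [b ↦ ⟦t⟧] past [a ↦ ⟦t'⟧].

open import Defs
open import Data.Nat as ℕ using (ℕ; zero; suc; _+_; _≤_; _<_; s≤s; z≤n; _⊔_)
import Data.Nat.Properties as ℕP
open import Data.Integer as ℤ using (ℤ; +_)
import Data.Integer.Properties as ℤP
open import Algebra.Bundles using (AbelianGroup)
open import Algebra.Properties.Group (AbelianGroup.group ℤP.+-0-abelianGroup) using (∙-cancelʳ)
open import Data.Product using (_×_; _,_; proj₁; proj₂; ∃; ∃-syntax) renaming (map₁ to ×-map₁)
open import Data.Sum using (_⊎_; inj₁; inj₂) renaming (map₁ to ⊎-map₁)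
open import Data.Maybe using (just)
open import Data.Maybe.Properties using (just-injective)
open import Data.List using (List; []; _∷_; _++_; map; length; concat)
open import Data.List.Properties using (map-++)
open import Data.List.Membership.Propositional using (_∈_; _∉_)
open import Data.List.Membership.Propositional.Properties using (∈-++⁺ˡ; ∈-++⁺ʳ; ∈-++⁻; ∈-map⁻)
open import Data.List.Relation.Unary.Any using (here; there)
open import Data.List.Relation.Unary.All using (All; []; _∷_)
open import Data.Unit using (⊤; tt)
open import Data.Empty using (⊥; ⊥-elim)
open import Relation.Binary.PropositionalEquality
open import Relation.Nullary using (yes; no)

∉-++ˡ : ∀ {c : Atom} {L M} → c ∉ L ++ M → c ∉ L
∉-++ˡ h x = h (∈-++⁺ˡ x)

∉-++ʳ : ∀ {c : Atom} L {M} → c ∉ L ++ M → c ∉ M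
∉-++ʳ L h x = h (∈-++⁺ʳ L x)

∉-singleton : ∀ {c d : Atom} → c ∉ d ∷ [] → c ≢ d
∉-singleton h e = h (here e)

-- Every atom of L has index at most maxIndex L, so index suc (maxIndex L) is unused.
maxIndex : List Atom → ℕ
maxIndex [] = 0
maxIndex ((_ , n) ∷ L) = n ⊔ maxIndex L

maxIndex-≥ : ∀ {i n} L → (i , n) ∈ L → n ≤ maxIndex L
maxIndex-≥ ((_ , m) ∷ L) (here refl) = ℕP.m≤m⊔n m (maxIndex L)
maxIndex-≥ ((_ , m) ∷ L) (there x) = ℕP.≤-trans (maxIndex-≥ L x) (ℕP.m≤n⊔m m (maxIndex L))

Fresh : ℤ → List (List Atom) → Set
Fresh i Ls = ∃[ d ] (level d ≡ i × All (d ∉_) Ls)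

pick : ∀ i Ls → Fresh i Ls
pick i Ls = d , refl , spread Ls d∉
  where
  d : Atom
  d = (i , suc (maxIndex (concat Ls)))
  d∉ : d ∉ concat Ls
  d∉ x = ℕP.<-irrefl refl (maxIndex-≥ (concat Ls) x)
  spread : ∀ Ks → d ∉ concat Ks → All (d ∉_) Ks
  spread [] h = []
  spread (K ∷ Ks) h = ∉-++ˡ h ∷ spread Ks (∉-++ʳ K h)

closeV-openV : ∀ k c v → c ∉ atomsV v → closeV k c (openV k c v) ≡ v
closeV-openV k c (fr a) h with a ≟A c
... | yes e = ⊥-elim (h (here (sym e)))
... | no _ = refl
closeV-openV k c (bd n) h with k ℕ.≟ n
... | no _ = refl
... | yes refl with c ≟A c
... | yes _ = refl
... | no ne = ⊥-elim (ne refl)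

mutual
  closeP-openP : ∀ k c Z → c ∉ atomsP Z → closeP k c (openP k c Z) ≡ Z
  closeP-openP k c (and Xs) h = cong and (closeL-openL k c Xs h)
  closeP-openP k c (neg X) h = cong neg (closeP-openP k c X h)
  closeP-openP k c (all i X) h = cong (all i) (closeP-openP (suc k) c X h)
  closeP-openP k c (elt y v) h =
    cong₂ elt (closeS-openS k c y (∉-++ˡ h)) (closeV-openV k c v (∉-++ʳ (atomsS y) h))

  closeL-openL : ∀ k c Xs → c ∉ atomsL Xs → closeL k c (openL k c Xs) ≡ Xs
  closeL-openL k c [] h = refl
  closeL-openL k c (X ∷ Xs) h = cong₂ _∷_ (closeP-openP k c X (∉-++ˡ h)) (closeL-openL k c Xs (∉-++ʳ (atomsP X) h))

  closeS-openS : ∀ k c z → c ∉ atomsS z → closeS k c (openS k c z) ≡ z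
  closeS-openS k c (atm v) h = cong atm (closeV-openV k c v h)
  closeS-openS k c (st j X) h = cong (st j) (closeP-openP (suc k) c X h)

∈-++-cases : ∀ {A : Set} {P : Set} {d : A} L {M} → (d ∈ L → P) → (d ∈ M → P) → d ∈ L ++ M → P
∈-++-cases L f g x with ∈-++⁻ L x
... | inj₁ y = f y
... | inj₂ y = g y

atomsV-open : ∀ {d} k c v → d ∈ atomsV (openV k c v) → d ∈ atomsV v ⊎ d ≡ c
atomsV-open k c (fr a) x = inj₁ x
atomsV-open k c (bd n) x with k ℕ.≟ n
atomsV-open k c (bd n) (here e) | yes _ = inj₂ e
atomsV-open k c (bd n) () | no _

mutual
  atomsP-open : ∀ {d} k c Z → d ∈ atomsP (openP k c Z) → d ∈ atomsP Z ⊎ d ≡ c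
  atomsP-open k c (and Xs) x = atomsL-open k c Xs x
  atomsP-open k c (neg X) x = atomsP-open k c X x
  atomsP-open k c (all i X) x = atomsP-open (suc k) c X x
  atomsP-open k c (elt y v) x =
    ∈-++-cases (atomsS (openS k c y))
      (λ h → ⊎-map₁ ∈-++⁺ˡ (atomsS-open k c y h))
      (λ h → ⊎-map₁ (∈-++⁺ʳ (atomsS y)) (atomsV-open k c v h)) x

  atomsL-open : ∀ {d} k c Xs → d ∈ atomsL (openL k c Xs) → d ∈ atomsL Xs ⊎ d ≡ c
  atomsL-open k c [] ()
  atomsL-open k c (X ∷ Xs) x =
    ∈-++-cases (atomsP (openP k c X))
      (λ h → ⊎-map₁ ∈-++⁺ˡ (atomsP-open k c X h))
      (λ h → ⊎-map₁ (∈-++⁺ʳ (atomsP X)) (atomsL-open k c Xs h)) x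

  atomsS-open : ∀ {d} k c z → d ∈ atomsS (openS k c z) → d ∈ atomsS z ⊎ d ≡ c
  atomsS-open k c (atm v) x = atomsV-open k c v x
  atomsS-open k c (st j X) x = atomsP-open (suc k) c X x

∉-open : ∀ {d} k c Z → d ∉ atomsP Z → d ≢ c → d ∉ atomsP (openP k c Z)
∉-open k c Z h ne x with atomsP-open k c Z x
... | inj₁ y = h y
... | inj₂ y = ne y

atomsV-close : ∀ {d} k c v → d ∈ atomsV (closeV k c v) → d ∈ atomsV v × d ≢ c
atomsV-close k c (bd n) ()
atomsV-close k c (fr a) x with a ≟A c
atomsV-close k c (fr a) () | yes _
atomsV-close k c (fr a) (here refl) | no ne = here refl , ne

mutual
  atomsP-close : ∀ {d} k c Z → d ∈ atomsP (closeP k c Z) → d ∈ atomsP Z × d ≢ c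
  atomsP-close k c (and Xs) x = atomsL-close k c Xs x
  atomsP-close k c (neg X) x = atomsP-close k c X x
  atomsP-close k c (all i X) x = atomsP-close (suc k) c X x
  atomsP-close k c (elt y v) x =
    ∈-++-cases (atomsS (closeS k c y))
      (λ h → ×-map₁ ∈-++⁺ˡ (atomsS-close k c y h))
      (λ h → ×-map₁ (∈-++⁺ʳ (atomsS y)) (atomsV-close k c v h)) x

  atomsL-close : ∀ {d} k c Xs → d ∈ atomsL (closeL k c Xs) → d ∈ atomsL Xs × d ≢ c
  atomsL-close k c [] ()
  atomsL-close k c (X ∷ Xs) x =
    ∈-++-cases (atomsP (closeP k c X))
      (λ h → ×-map₁ ∈-++⁺ˡ (atomsP-close k c X h))
      (λ h → ×-map₁ (∈-++⁺ʳ (atomsP X)) (atomsL-close k c Xs h)) x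

  atomsS-close : ∀ {d} k c z → d ∈ atomsS (closeS k c z) → d ∈ atomsS z × d ≢ c
  atomsS-close k c (atm v) x = atomsV-close k c v x
  atomsS-close k c (st j X) x = atomsP-close (suc k) c X x

∉-close-self : ∀ k c Z → c ∉ atomsP (closeP k c Z)
∉-close-self k c Z x = proj₂ (atomsP-close k c Z x) refl

-- Swapping two atoms p and q, on atoms and on both syntaxes.  Its interaction with opening,
-- closing and supports is what makes the choice of fresh atoms irrelevant.
module Swap (p q : Atom) where

  sA : Atom → Atom
  sA c with c ≟A p
  ... | yes _ = q
  ... | no _ with c ≟A q
  ... | yes _ = p
  ... | no _ = c

  sA-p : sA p ≡ q
  sA-p with p ≟A p
  ... | yes _ = refl
  ... | no ne = ⊥-elim (ne refl)

  sA-q : sA q ≡ p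
  sA-q with q ≟A p
  ... | yes e = e
  ... | no _ with q ≟A q
  ... | yes _ = refl
  ... | no ne = ⊥-elim (ne refl)

  sA-fix : ∀ {c} → c ≢ p → c ≢ q → sA c ≡ c
  sA-fix {c} c≢p c≢q with c ≟A p
  ... | yes e = ⊥-elim (c≢p e)
  ... | no _ with c ≟A q
  ... | yes e = ⊥-elim (c≢q e)
  ... | no _ = refl

  sA-invol : ∀ c → sA (sA c) ≡ c
  sA-invol c with c ≟A p
  ... | yes refl = sA-q
  ... | no c≢p with c ≟A q
  ... | yes refl = sA-p
  ... | no c≢q = sA-fix c≢p c≢q

  sA-inj : ∀ {c d} → sA c ≡ sA d → c ≡ d
  sA-inj {c} {d} e = trans (sym (sA-invol c)) (trans (cong sA e) (sA-invol d))

  sA-level : level p ≡ level q → ∀ c → level (sA c) ≡ level c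
  sA-level e c with c ≟A p
  ... | yes refl = sym e
  ... | no _ with c ≟A q
  ... | yes refl = e
  ... | no _ = refl

  sV : Vr → Vr
  sV (fr a) = fr (sA a)
  sV (bd n) = bd n

  mutual
    sP : Pr → Pr
    sP (and Xs) = and (sL Xs)
    sP (neg X) = neg (sP X)
    sP (all i X) = all i (sP X)
    sP (elt y v) = elt (sS y) (sV v)

    sL : List Pr → List Pr
    sL [] = []
    sL (X ∷ Xs) = sP X ∷ sL Xs

    sS : St → St
    sS (atm v) = atm (sV v)
    sS (st j X) = st j (sP X)

  mutual
    sF : Fm → Fm
    sF ⊥f = ⊥f
    sF (¬f φ) = ¬f (sF φ)
    sF (φ ∧f ψ) = sF φ ∧f sF ψ
    sF (∀f i φ) = ∀f i (sF φ)
    sF (s ∈f t) = sT s ∈f sT t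

    sT : Tm → Tm
    sT (var v) = var (sV v)
    sT (cmp j φ) = cmp j (sF φ)

  sV-open : ∀ k c v → sV (openV k c v) ≡ openV k (sA c) (sV v)
  sV-open k c (fr a) = refl
  sV-open k c (bd n) with k ℕ.≟ n
  ... | yes _ = refl
  ... | no _ = refl

  mutual
    sP-open : ∀ k c Z → sP (openP k c Z) ≡ openP k (sA c) (sP Z)
    sP-open k c (and Xs) = cong and (sL-open k c Xs)
    sP-open k c (neg X) = cong neg (sP-open k c X)
    sP-open k c (all i X) = cong (all i) (sP-open (suc k) c X)
    sP-open k c (elt y v) = cong₂ elt (sS-open k c y) (sV-open k c v)

    sL-open : ∀ k c Xs → sL (openL k c Xs) ≡ openL k (sA c) (sL Xs)
    sL-open k c [] = refl
    sL-open k c (X ∷ Xs) = cong₂ _∷_ (sP-open k c X) (sL-open k c Xs)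

    sS-open : ∀ k c z → sS (openS k c z) ≡ openS k (sA c) (sS z)
    sS-open k c (atm v) = cong atm (sV-open k c v)
    sS-open k c (st j X) = cong (st j) (sP-open (suc k) c X)

  mutual
    sF-open : ∀ k c φ → sF (openF k c φ) ≡ openF k (sA c) (sF φ)
    sF-open k c ⊥f = refl
    sF-open k c (¬f φ) = cong ¬f (sF-open k c φ)
    sF-open k c (φ ∧f ψ) = cong₂ _∧f_ (sF-open k c φ) (sF-open k c ψ)
    sF-open k c (∀f i φ) = cong (∀f i) (sF-open (suc k) c φ)
    sF-open k c (s ∈f t) = cong₂ _∈f_ (sT-open k c s) (sT-open k c t)

    sT-open : ∀ k c t → sT (openT k c t) ≡ openT k (sA c) (sT t)
    sT-open k c (var v) = cong var (sV-open k c v)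
    sT-open k c (cmp j φ) = cong (cmp j) (sF-open (suc k) c φ)

  sV-close : ∀ k c v → sV (closeV k c v) ≡ closeV k (sA c) (sV v)
  sV-close k c (bd n) = refl
  sV-close k c (fr a) with a ≟A c | sA a ≟A sA c
  ... | yes _ | yes _ = refl
  ... | yes e | no ne = ⊥-elim (ne (cong sA e))
  ... | no ne | yes e = ⊥-elim (ne (sA-inj e))
  ... | no _ | no _ = refl

  mutual
    sP-close : ∀ k c Z → sP (closeP k c Z) ≡ closeP k (sA c) (sP Z)
    sP-close k c (and Xs) = cong and (sL-close k c Xs)
    sP-close k c (neg X) = cong neg (sP-close k c X)
    sP-close k c (all i X) = cong (all i) (sP-close (suc k) c X)
    sP-close k c (elt y v) = cong₂ elt (sS-close k c y) (sV-close k c v)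

    sL-close : ∀ k c Xs → sL (closeL k c Xs) ≡ closeL k (sA c) (sL Xs)
    sL-close k c [] = refl
    sL-close k c (X ∷ Xs) = cong₂ _∷_ (sP-close k c X) (sL-close k c Xs)

    sS-close : ∀ k c z → sS (closeS k c z) ≡ closeS k (sA c) (sS z)
    sS-close k c (atm v) = cong atm (sV-close k c v)
    sS-close k c (st j X) = cong (st j) (sP-close (suc k) c X)

  sV-atoms : ∀ v → atomsV (sV v) ≡ map sA (atomsV v)
  sV-atoms (fr a) = refl
  sV-atoms (bd n) = refl

  mutual
    sP-atoms : ∀ Z → atomsP (sP Z) ≡ map sA (atomsP Z)
    sP-atoms (and Xs) = sL-atoms Xs
    sP-atoms (neg X) = sP-atoms X
    sP-atoms (all i X) = sP-atoms X
    sP-atoms (elt y v) = trans (cong₂ _++_ (sS-atoms y) (sV-atoms v)) (sym (map-++ sA (atomsS y) (atomsV v)))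

    sL-atoms : ∀ Xs → atomsL (sL Xs) ≡ map sA (atomsL Xs)
    sL-atoms [] = refl
    sL-atoms (X ∷ Xs) = trans (cong₂ _++_ (sP-atoms X) (sL-atoms Xs)) (sym (map-++ sA (atomsP X) (atomsL Xs)))

    sS-atoms : ∀ z → atomsS (sS z) ≡ map sA (atomsS z)
    sS-atoms (atm v) = sV-atoms v
    sS-atoms (st j X) = sP-atoms X

  mutual
    sF-atoms : ∀ φ → atomsF (sF φ) ≡ map sA (atomsF φ)
    sF-atoms ⊥f = refl
    sF-atoms (¬f φ) = sF-atoms φ
    sF-atoms (φ ∧f ψ) = trans (cong₂ _++_ (sF-atoms φ) (sF-atoms ψ)) (sym (map-++ sA (atomsF φ) (atomsF ψ)))
    sF-atoms (∀f i φ) = sF-atoms φ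
    sF-atoms (s ∈f t) = trans (cong₂ _++_ (sT-atoms s) (sT-atoms t)) (sym (map-++ sA (atomsT s) (atomsT t)))

    sT-atoms : ∀ t → atomsT (sT t) ≡ map sA (atomsT t)
    sT-atoms (var v) = sV-atoms v
    sT-atoms (cmp j φ) = sF-atoms φ

  ∉-map : ∀ {c L} → c ∉ L → sA c ∉ map sA L
  ∉-map {c} h x with ∈-map⁻ sA x
  ... | d , d∈ , e = h (subst (_∈ _) (sym (sA-inj e)) d∈)

  sV-fix : ∀ v → p ∉ atomsV v → q ∉ atomsV v → sV v ≡ v
  sV-fix (fr a) hp hq = cong fr (sA-fix (λ e → hp (here (sym e))) (λ e → hq (here (sym e))))
  sV-fix (bd n) hp hq = refl

  mutual
    sP-fix : ∀ Z → p ∉ atomsP Z → q ∉ atomsP Z → sP Z ≡ Z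
    sP-fix (and Xs) hp hq = cong and (sL-fix Xs hp hq)
    sP-fix (neg X) hp hq = cong neg (sP-fix X hp hq)
    sP-fix (all i X) hp hq = cong (all i) (sP-fix X hp hq)
    sP-fix (elt y v) hp hq =
      cong₂ elt (sS-fix y (∉-++ˡ hp) (∉-++ˡ hq)) (sV-fix v (∉-++ʳ (atomsS y) hp) (∉-++ʳ (atomsS y) hq))

    sL-fix : ∀ Xs → p ∉ atomsL Xs → q ∉ atomsL Xs → sL Xs ≡ Xs
    sL-fix [] hp hq = refl
    sL-fix (X ∷ Xs) hp hq =
      cong₂ _∷_ (sP-fix X (∉-++ˡ hp) (∉-++ˡ hq)) (sL-fix Xs (∉-++ʳ (atomsP X) hp) (∉-++ʳ (atomsP X) hq))

    sS-fix : ∀ z → p ∉ atomsS z → q ∉ atomsS z → sS z ≡ z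
    sS-fix (atm v) hp hq = cong atm (sV-fix v hp hq)
    sS-fix (st j X) hp hq = cong (st j) (sP-fix X hp hq)

  mutual
    sF-fix : ∀ φ → p ∉ atomsF φ → q ∉ atomsF φ → sF φ ≡ φ
    sF-fix ⊥f hp hq = refl
    sF-fix (¬f φ) hp hq = cong ¬f (sF-fix φ hp hq)
    sF-fix (φ ∧f ψ) hp hq =
      cong₂ _∧f_ (sF-fix φ (∉-++ˡ hp) (∉-++ˡ hq)) (sF-fix ψ (∉-++ʳ (atomsF φ) hp) (∉-++ʳ (atomsF φ) hq))
    sF-fix (∀f i φ) hp hq = cong (∀f i) (sF-fix φ hp hq)
    sF-fix (s ∈f t) hp hq =
      cong₂ _∈f_ (sT-fix s (∉-++ˡ hp) (∉-++ˡ hq)) (sT-fix t (∉-++ʳ (atomsT s) hp) (∉-++ʳ (atomsT s) hq))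

    sT-fix : ∀ t → p ∉ atomsT t → q ∉ atomsT t → sT t ≡ t
    sT-fix (var v) hp hq = cong var (sV-fix v hp hq)
    sT-fix (cmp j φ) hp hq = cong (cmp j) (sF-fix φ hp hq)

  sP-open-rename : ∀ X → p ∉ atomsP X → q ∉ atomsP X → sP (openP 0 p X) ≡ openP 0 q X
  sP-open-rename X hp hq = trans (sP-open 0 p X) (cong₂ (openP 0) sA-p (sP-fix X hp hq))

  sF-open-rename : ∀ φ → p ∉ atomsF φ → q ∉ atomsF φ → sF (openF 0 p φ) ≡ openF 0 q φ
  sF-open-rename φ hp hq = trans (sF-open 0 p φ) (cong₂ (openF 0) sA-p (sF-fix φ hp hq))

  sP-close-rename : ∀ W → q ∉ atomsP (closeP 0 p W) → closeP 0 q (sP W) ≡ closeP 0 p W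
  sP-close-rename W hq = begin
    closeP 0 q (sP W)        ≡⟨ cong (λ c → closeP 0 c (sP W)) (sym sA-p) ⟩
    closeP 0 (sA p) (sP W)   ≡⟨ sym (sP-close 0 p W) ⟩
    sP (closeP 0 p W)        ≡⟨ sP-fix (closeP 0 p W) (∉-close-self 0 p W) hq ⟩
    closeP 0 p W             ∎
    where open ≡-Reasoning

shiftV : Vr → Vr
shiftV (fr a) = fr a
shiftV (bd n) = bd (suc n)

lvV-shift : ∀ j Γ v → lvV (j ∷ Γ) (shiftV v) ≡ lvV Γ v
lvV-shift j Γ (fr a) = refl
lvV-shift j Γ (bd n) = refl

openV-suc : ∀ k c n → openV (suc k) c (bd (suc n)) ≡ shiftV (openV k c (bd n))
openV-suc k c n with k ℕ.≟ n | suc k ℕ.≟ suc n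
... | yes _ | yes _ = refl
... | yes e | no ne = ⊥-elim (ne (cong suc e))
... | no ne | yes e = ⊥-elim (ne (ℕP.suc-injective e))
... | no _ | no _ = refl

closeV-suc : ∀ k c a → closeV (suc k) c (fr a) ≡ shiftV (closeV k c (fr a))
closeV-suc k c a with a ≟A c
... | yes _ = refl
... | no _ = refl

lvV-bd-in-scope : ∀ Γ n {i} → lvV Γ (bd n) ≡ just i → n < length Γ
lvV-bd-in-scope [] n ()
lvV-bd-in-scope (j ∷ Γ) zero e = s≤s z≤n
lvV-bd-in-scope (j ∷ Γ) (suc n) e = s≤s (lvV-bd-in-scope Γ n e)

lvV-open : ∀ Δ i c v {l} → lvV (Δ ++ i ∷ []) v ≡ just l → level c ≡ i → lvV Δ (openV (length Δ) c v) ≡ just l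
lvV-open Δ i c (fr a) e lc = e
lvV-open [] i c (bd zero) e lc = trans (cong just lc) e
lvV-open [] i c (bd (suc n)) () lc
lvV-open (j ∷ Δ) i c (bd zero) e lc = e
lvV-open (j ∷ Δ) i c (bd (suc n)) e lc =
  trans (cong (lvV (j ∷ Δ)) (openV-suc (length Δ) c n))
        (trans (lvV-shift j Δ (openV (length Δ) c (bd n))) (lvV-open Δ i c (bd n) e lc))

lvV-close : ∀ Δ c v {l} → lvV Δ v ≡ just l → lvV (Δ ++ level c ∷ []) (closeV (length Δ) c v) ≡ just l
lvV-close [] c (fr a) e with a ≟A c
... | yes refl = e
... | no _ = e
lvV-close [] c (bd n) ()
lvV-close (j ∷ Δ) c (fr a) e =
  trans (cong (lvV (j ∷ Δ ++ level c ∷ [])) (closeV-suc (length Δ) c a))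
        (trans (lvV-shift j (Δ ++ level c ∷ []) (closeV (length Δ) c (fr a))) (lvV-close Δ c (fr a) e))
lvV-close (j ∷ Δ) c (bd zero) e = e
lvV-close (j ∷ Δ) c (bd (suc n)) e = lvV-close Δ c (bd n) e

openV-closeV : ∀ Δ c v {l} → lvV Δ v ≡ just l → openV (length Δ) c (closeV (length Δ) c v) ≡ v
openV-closeV Δ c (fr a) e with a ≟A c
... | no _ = refl
... | yes refl with length Δ ℕ.≟ length Δ
... | yes _ = refl
... | no ne = ⊥-elim (ne refl)
openV-closeV Δ c (bd n) e with length Δ ℕ.≟ n
... | yes refl = ⊥-elim (ℕP.<-irrefl refl (lvV-bd-in-scope Δ n e))
... | no _ = refl

openV-out-of-scope : ∀ Γ k c v {l} → lvV Γ v ≡ just l → length Γ ≤ k → openV k c v ≡ v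
openV-out-of-scope Γ k c (fr a) e le = refl
openV-out-of-scope Γ k c (bd n) e le with k ℕ.≟ n
... | yes refl = ⊥-elim (ℕP.<-irrefl refl (ℕP.<-≤-trans (lvV-bd-in-scope Γ n e) le))
... | no _ = refl

module Equivariance (p q : Atom) (lpq : level p ≡ level q) where
  open Swap p q

  ∉-sP : ∀ {c} Z → c ∉ atomsP Z → sA c ∉ atomsP (sP Z)
  ∉-sP {c} Z h = subst (λ L → sA c ∉ L) (sym (sP-atoms Z)) (∉-map h)

  ∉-sS : ∀ {c} z → c ∉ atomsS z → sA c ∉ atomsS (sS z)
  ∉-sS {c} z h = subst (λ L → sA c ∉ L) (sym (sS-atoms z)) (∉-map h)

  ∉-sF : ∀ {c} φ → c ∉ atomsF φ → sA c ∉ atomsF (sF φ)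
  ∉-sF {c} φ h = subst (λ L → sA c ∉ L) (sym (sF-atoms φ)) (∉-map h)

  ≢-sA : ∀ {c d} → c ≢ d → sA c ≢ sA d
  ≢-sA ne e = ne (sA-inj e)

  level-sA : ∀ {c i} → level c ≡ i → level (sA c) ≡ i
  level-sA {c} e = trans (sA-level lpq c) e

  mutual
    swapSigP : ∀ {Z a x W} → SigP Z a x W → SigP (sP Z) (sA a) (sS x) (sP W)
    swapSigP (sig-and D) = sig-and (swapSigL D)
    swapSigP (sig-neg D) = sig-neg (swapSigP D)
    swapSigP (sig-all {i} {X} {a} {x} {W} b lb ne bX bx D) =
      subst (λ R → SigP (all i (sP X)) (sA a) (sS x) (all i R)) (sym (sP-close 0 b W))
        (sig-all (sA b) (level-sA lb) (≢-sA ne) (∉-sP X bX) (∉-sS x bx)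
          (subst (λ Z → SigP Z (sA a) (sS x) (sP W)) (sP-open 0 b X) (swapSigP D)))
    swapSigP (sig-elt-atm D) = sig-elt-atm (swapSigS D)
    swapSigP (sig-elt-st {y} {a} {j} {X'} {Y} {W} a' la ne aX ay Dy DW) =
      sig-elt-st (sA a') (level-sA la) (≢-sA ne) (∉-sP X' aX) (∉-sS y ay) (swapSigS Dy)
        (subst (λ Z → SigP Z (sA a') (sS Y) (sP W)) (sP-open 0 a' X') (swapSigP DW))
    swapSigP (sig-elt-oth ne D) = sig-elt-oth (≢-sA ne) (swapSigS D)

    swapSigL : ∀ {Xs a x Ys} → SigL Xs a x Ys → SigL (sL Xs) (sA a) (sS x) (sL Ys)
    swapSigL sigL-[] = sigL-[]
    swapSigL (sigL-∷ D E) = sigL-∷ (swapSigP D) (swapSigL E)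

    swapSigS : ∀ {z a x w} → SigS z a x w → SigS (sS z) (sA a) (sS x) (sS w)
    swapSigS sig-atm-eq = sig-atm-eq
    swapSigS (sig-atm-neq ne) = sig-atm-neq (≢-sA ne)
    swapSigS (sig-st {j} {X} {a} {x} {W} c lc ne cX cx D) =
      subst (λ R → SigS (st j (sP X)) (sA a) (sS x) (st j R)) (sym (sP-close 0 c W))
        (sig-st (sA c) (level-sA lc) (≢-sA ne) (∉-sP X cX) (∉-sS x cx)
          (subst (λ Z → SigP Z (sA a) (sS x) (sP W)) (sP-open 0 c X) (swapSigP D)))

  swapMemb : ∀ {y x W} → Memb y x W → Memb (sS y) (sS x) (sP W)
  swapMemb memb-atm = memb-atm
  swapMemb (memb-st {y} {j} {X} {W} b lb bX by D) =
    memb-st (sA b) (level-sA lb) (∉-sP X bX) (∉-sS y by)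
      (subst (λ Z → SigP Z (sA b) (sS y) (sP W)) (sP-open 0 b X) (swapSigP D))

  mutual
    swapIntF : ∀ {φ X} → IntF φ X → IntF (sF φ) (sP X)
    swapIntF int-⊥ = int-⊥
    swapIntF (int-¬ D) = int-¬ (swapIntF D)
    swapIntF (int-∧ D E) = int-∧ (swapIntF D) (swapIntF E)
    swapIntF (int-∀ {i} {φ} {X} a la aφ D) =
      subst (λ R → IntF (∀f i (sF φ)) (all i R)) (sym (sP-close 0 a X))
        (int-∀ (sA a) (level-sA la) (∉-sF φ aφ)
          (subst (λ ψ → IntF ψ (sP X)) (sF-open 0 a φ) (swapIntF D)))
    swapIntF (int-∈ D E M) = int-∈ (swapIntT D) (swapIntT E) (swapMemb M)

    swapIntT : ∀ {t x} → IntT t x → IntT (sT t) (sS x)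
    swapIntT int-var = int-var
    swapIntT (int-cmp {j} {φ} {X} a la aφ D) =
      subst (λ R → IntT (cmp j (sF φ)) (st j R)) (sym (sP-close 0 a X))
        (int-cmp (sA a) (level-sA la) (∉-sF φ aφ)
          (subst (λ ψ → IntF ψ (sP X)) (sF-open 0 a φ) (swapIntF D)))

mutual
  atomsSigP : ∀ {Z a x W d} → SigP Z a x W → d ∈ atomsP W → (d ∈ atomsP Z × d ≢ a) ⊎ d ∈ atomsS x
  atomsSigP (sig-and D) h = atomsSigL D h
  atomsSigP (sig-neg D) h = atomsSigP D h
  atomsSigP (sig-all {X = X} {W = W} b lb ne bX bx D) h = atomsBinder X D (atomsP-close 0 b W h)
  atomsSigP (sig-elt-atm {y' = y'} D) h =
    ∈-++-cases (atomsS y') (λ h' → ⊎-map₁ (×-map₁ ∈-++⁺ˡ) (atomsSigS D h')) inj₂ h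
  atomsSigP (sig-elt-st {X' = X'} a' la ne aX ay Dy DW) h with atomsSigP DW h
  ... | inj₁ (h' , d≢a') with atomsP-open 0 a' X' h'
  ...   | inj₁ h'' = inj₂ h''
  ...   | inj₂ e = ⊥-elim (d≢a' e)
  atomsSigP (sig-elt-st a' la ne aX ay Dy DW) h | inj₂ h' = ⊎-map₁ (×-map₁ ∈-++⁺ˡ) (atomsSigS Dy h')
  atomsSigP (sig-elt-oth {y} {y' = y'} ne D) h =
    ∈-++-cases (atomsS y') (λ h' → ⊎-map₁ (×-map₁ ∈-++⁺ˡ) (atomsSigS D h'))
      (λ { (here refl) → inj₁ (∈-++⁺ʳ (atomsS y) (here refl) , ne) }) h

  atomsSigL : ∀ {Xs a x Ys d} → SigL Xs a x Ys → d ∈ atomsL Ys → (d ∈ atomsL Xs × d ≢ a) ⊎ d ∈ atomsS x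
  atomsSigL sigL-[] ()
  atomsSigL (sigL-∷ {X} {Y = Y} D E) =
    ∈-++-cases (atomsP Y) (λ h → ⊎-map₁ (×-map₁ ∈-++⁺ˡ) (atomsSigP D h))
      (λ h → ⊎-map₁ (×-map₁ (∈-++⁺ʳ (atomsP X))) (atomsSigL E h))

  atomsSigS : ∀ {z a x w d} → SigS z a x w → d ∈ atomsS w → (d ∈ atomsS z × d ≢ a) ⊎ d ∈ atomsS x
  atomsSigS sig-atm-eq h = inj₂ h
  atomsSigS (sig-atm-neq ne) (here refl) = inj₁ (here refl , ne)
  atomsSigS (sig-st {X = X} {W = W} b lb ne bX bx D) h = atomsBinder X D (atomsP-close 0 b W h)

  atomsBinder : ∀ {b a x W d} X → SigP (openP 0 b X) a x W → d ∈ atomsP W × d ≢ b →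
                (d ∈ atomsP X × d ≢ a) ⊎ d ∈ atomsS x
  atomsBinder X D (h , d≢b) with atomsSigP D h
  ... | inj₂ h' = inj₂ h'
  ... | inj₁ (h' , d≢a) with atomsP-open 0 _ X h'
  ...   | inj₁ h'' = inj₁ (h'' , d≢a)
  ...   | inj₂ e = ⊥-elim (d≢b e)

∉-SigP : ∀ {Z a x W d} → SigP Z a x W → (d ∉ atomsP Z ⊎ d ≡ a) → d ∉ atomsS x → d ∉ atomsP W
∉-SigP D hZ hx h with atomsSigP D h
... | inj₂ h' = hx h'
... | inj₁ (h' , d≢a) with hZ
...   | inj₁ d∉Z = d∉Z h'
...   | inj₂ e = d≢a e

∉-SigS : ∀ {z a x w d} → SigS z a x w → (d ∉ atomsS z ⊎ d ≡ a) → d ∉ atomsS x → d ∉ atomsS w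
∉-SigS D hz hx h with atomsSigS D h
... | inj₂ h' = hx h'
... | inj₁ (h' , d≢a) with hz
...   | inj₁ d∉z = d∉z h'
...   | inj₂ e = d≢a e

-- Renaming: the fresh atom of a binder clause may be replaced by any other sufficiently fresh atom
-- of the same level (swap the two atoms and use equivariance).

renameSigBody : ∀ {X a x W b} d → level b ≡ level d → b ≢ a → b ∉ atomsP X → b ∉ atomsS x →
                d ≢ a → d ∉ atomsP X → d ∉ atomsS x → SigP (openP 0 b X) a x W →
                ∃ λ W' → SigP (openP 0 d X) a x W' × closeP 0 b W ≡ closeP 0 d W'
renameSigBody {X} {a} {x} {W} {b} d lbd b≢a bX bx d≢a dX dx D =
  sP W ,
  subst₂ (λ Z y → SigP Z a y (sP W)) (sP-open-rename X bX dX) (sS-fix x bx dx)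
    (subst (λ a' → SigP (sP (openP 0 b X)) a' (sS x) (sP W)) (sA-fix (λ e → b≢a (sym e)) (λ e → d≢a (sym e)))
      (swapSigP D)) ,
  sym (sP-close-rename W d∉)
  where
  open Swap b d
  open Equivariance b d lbd
  d∉ : d ∉ atomsP (closeP 0 b W)
  d∉ h with atomsP-close 0 b W h
  ... | h' , d≢b = ∉-SigP D (inj₁ (∉-open 0 b X dX d≢b)) dx h'

renameSigAll : ∀ {i X a x R} → SigP (all i X) a x R → ∀ d → level d ≡ i → d ≢ a → d ∉ atomsP X → d ∉ atomsS x →
               ∃ λ W → SigP (openP 0 d X) a x W × R ≡ all i (closeP 0 d W)
renameSigAll (sig-all b lb b≢a bX bx D) d ld d≢a dX dx with renameSigBody d (trans lb (sym ld)) b≢a bX bx d≢a dX dx D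
... | W , D' , e = W , D' , cong (all _) e

renameSigSt : ∀ {j X a x R} → SigS (st j X) a x R → ∀ d → level d ≡ j → d ≢ a → d ∉ atomsP X → d ∉ atomsS x →
              ∃ λ W → SigP (openP 0 d X) a x W × R ≡ st j (closeP 0 d W)
renameSigSt (sig-st b lb b≢a bX bx D) d ld d≢a dX dx with renameSigBody d (trans lb (sym ld)) b≢a bX bx d≢a dX dx D
... | W , D' , e = W , D' , cong (st _) e

-- the body of elt(y,b)[b ↦ st([b]X)] and of y ∈̃ st([b]X): here the opened atom is also the one
-- being replaced, and the result does not mention it
renameSelfSig : ∀ {X b y W} d → level b ≡ level d → b ∉ atomsP X → b ∉ atomsS y → d ∉ atomsP X → d ∉ atomsS y →
                SigP (openP 0 b X) b y W → SigP (openP 0 d X) d y W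
renameSelfSig {X} {b} {y} {W} d lbd bX by dX dy D with d ≟A b
... | yes refl = D
... | no d≢b = subst₂ (λ Z y' → SigP Z d y' W) (sP-open-rename X bX dX) (sS-fix y by dy)
                 (subst₂ (λ a' W' → SigP (sP (openP 0 b X)) a' (sS y) W') sA-p eW (swapSigP D))
  where
  open Swap b d
  open Equivariance b d lbd
  eW : sP W ≡ W
  eW = sP-fix W (∉-SigP D (inj₂ refl) by) (∉-SigP D (inj₁ (∉-open 0 b X dX d≢b)) dy)

renameSigEltSt : ∀ {y a j X' R} → SigP (elt y (fr a)) a (st j X') R →
                 ∀ d → level d ≡ j → d ≢ a → d ∉ atomsP X' → d ∉ atomsS y →
                 ∃ λ Y → SigS y a (st j X') Y × SigP (openP 0 d X') d Y R
renameSigEltSt (sig-elt-st a' la a'≢a a'X a'y Dy DW) d ld d≢a dX dy =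
  _ , Dy , renameSelfSig d (trans la (sym ld)) a'X (∉-SigS Dy (inj₁ a'y) a'X) dX (∉-SigS Dy (inj₁ dy) dX) DW
renameSigEltSt (sig-elt-oth ne D) d ld d≢a dX dy = ⊥-elim (ne refl)

renameMemb : ∀ {y j X W} → Memb y (st j X) W → ∀ d → level d ≡ j → d ∉ atomsP X → d ∉ atomsS y →
             SigP (openP 0 d X) d y W
renameMemb (memb-st b lb bX by D) d ld dX dy = renameSelfSig d (trans lb (sym ld)) bX by dX dy D

renameIntBody : ∀ {φ X a} d → level a ≡ level d → a ∉ atomsF φ → d ∉ atomsF φ → d ∉ atomsP (closeP 0 a X) →
                IntF (openF 0 a φ) X → ∃ λ X' → IntF (openF 0 d φ) X' × closeP 0 a X ≡ closeP 0 d X'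
renameIntBody {φ} {X} {a} d lad aφ dφ dX D =
  sP X , subst (λ ψ → IntF ψ (sP X)) (sF-open-rename φ aφ dφ) (swapIntF D) , sym (sP-close-rename X dX)
  where
  open Swap a d
  open Equivariance a d lad

renameIntAll : ∀ {i φ X} → IntF (∀f i φ) X → ∀ d → level d ≡ i → d ∉ atomsF φ → d ∉ atomsP X →
               ∃ λ Xd → IntF (openF 0 d φ) Xd × X ≡ all i (closeP 0 d Xd)
renameIntAll (int-∀ a la aφ D) d ld dφ dX with renameIntBody d (trans la (sym ld)) aφ dφ dX D
... | X' , D' , e = X' , D' , cong (all _) e

renameIntCmp : ∀ {j φ x} → IntT (cmp j φ) x → ∀ d → level d ≡ j → d ∉ atomsF φ → d ∉ atomsS x →
               ∃ λ Xd → IntF (openF 0 d φ) Xd × x ≡ st j (closeP 0 d Xd)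
renameIntCmp (int-cmp a la aφ D) d ld dφ dx with renameIntBody d (trans la (sym ld)) aφ dφ dx D
... | X' , D' , e = X' , D' , cong (st _) e

LevelsAboveV : ℤ → Vr → Set
LevelsAboveV m (fr a) = m ℤ.≤ level a
LevelsAboveV m (bd n) = ⊤

mutual
  LevelsAboveF : ℤ → Fm → Set
  LevelsAboveF m ⊥f = ⊤
  LevelsAboveF m (¬f φ) = LevelsAboveF m φ
  LevelsAboveF m (φ ∧f ψ) = LevelsAboveF m φ × LevelsAboveF m ψ
  LevelsAboveF m (∀f i φ) = m ℤ.≤ i × LevelsAboveF m φ
  LevelsAboveF m (s ∈f t) = LevelsAboveT m s × LevelsAboveT m t

  LevelsAboveT : ℤ → Tm → Set
  LevelsAboveT m (var v) = LevelsAboveV m v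
  LevelsAboveT m (cmp j φ) = m ℤ.≤ j × LevelsAboveF m φ

floorV : Vr → ℤ
floorV (fr a) = level a
floorV (bd n) = + 0

mutual
  floorF : Fm → ℤ
  floorF ⊥f = + 0
  floorF (¬f φ) = floorF φ
  floorF (φ ∧f ψ) = floorF φ ℤ.⊓ floorF ψ
  floorF (∀f i φ) = i ℤ.⊓ floorF φ
  floorF (s ∈f t) = floorT s ℤ.⊓ floorT t

  floorT : Tm → ℤ
  floorT (var v) = floorV v
  floorT (cmp j φ) = j ℤ.⊓ floorF φ

≤-⊓ˡ : ∀ {m i j} → m ℤ.≤ i ℤ.⊓ j → m ℤ.≤ i
≤-⊓ˡ {m} {i} {j} h = ℤP.≤-trans h (ℤP.i⊓j≤i i j)

≤-⊓ʳ : ∀ {m i j} → m ℤ.≤ i ℤ.⊓ j → m ℤ.≤ j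
≤-⊓ʳ {m} {i} {j} h = ℤP.≤-trans h (ℤP.i⊓j≤j i j)

levelsAboveV : ∀ m v → m ℤ.≤ floorV v → LevelsAboveV m v
levelsAboveV m (fr a) h = h
levelsAboveV m (bd n) h = tt

mutual
  levelsAboveF : ∀ m φ → m ℤ.≤ floorF φ → LevelsAboveF m φ
  levelsAboveF m ⊥f h = tt
  levelsAboveF m (¬f φ) h = levelsAboveF m φ h
  levelsAboveF m (φ ∧f ψ) h = levelsAboveF m φ (≤-⊓ˡ h) , levelsAboveF m ψ (≤-⊓ʳ h)
  levelsAboveF m (∀f i φ) h = ≤-⊓ˡ h , levelsAboveF m φ (≤-⊓ʳ h)
  levelsAboveF m (s ∈f t) h = levelsAboveT m s (≤-⊓ˡ h) , levelsAboveT m t (≤-⊓ʳ h)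

  levelsAboveT : ∀ m t → m ℤ.≤ floorT t → LevelsAboveT m t
  levelsAboveT m (var v) h = levelsAboveV m v h
  levelsAboveT m (cmp j φ) h = ≤-⊓ˡ h , levelsAboveF m φ (≤-⊓ʳ h)

levelsAboveV-open : ∀ m k c v → LevelsAboveV m v → m ℤ.≤ level c → LevelsAboveV m (openV k c v)
levelsAboveV-open m k c (fr a) h hc = h
levelsAboveV-open m k c (bd n) h hc with k ℕ.≟ n
... | yes _ = hc
... | no _ = tt

mutual
  levelsAboveF-open : ∀ m k c φ → LevelsAboveF m φ → m ℤ.≤ level c → LevelsAboveF m (openF k c φ)
  levelsAboveF-open m k c ⊥f h hc = tt
  levelsAboveF-open m k c (¬f φ) h hc = levelsAboveF-open m k c φ h hc
  levelsAboveF-open m k c (φ ∧f ψ) (h₁ , h₂) hc = levelsAboveF-open m k c φ h₁ hc , levelsAboveF-open m k c ψ h₂ hc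
  levelsAboveF-open m k c (∀f i φ) (h₁ , h₂) hc = h₁ , levelsAboveF-open m (suc k) c φ h₂ hc
  levelsAboveF-open m k c (s ∈f t) (h₁ , h₂) hc = levelsAboveT-open m k c s h₁ hc , levelsAboveT-open m k c t h₂ hc

  levelsAboveT-open : ∀ m k c t → LevelsAboveT m t → m ℤ.≤ level c → LevelsAboveT m (openT k c t)
  levelsAboveT-open m k c (var v) h hc = levelsAboveV-open m k c v h hc
  levelsAboveT-open m k c (cmp j φ) (h₁ , h₂) hc = h₁ , levelsAboveF-open m (suc k) c φ h₂ hc

lvT-open : ∀ Δ i c s {l} → lvT (Δ ++ i ∷ []) s ≡ just l → level c ≡ i → lvT Δ (openT (length Δ) c s) ≡ just l
lvT-open Δ i c (var v) e lc = lvV-open Δ i c v e lc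
lvT-open Δ i c (cmp j φ) e lc = e

mutual
  stratF-open : ∀ Δ i c φ → StratF (Δ ++ i ∷ []) φ → level c ≡ i → StratF Δ (openF (length Δ) c φ)
  stratF-open Δ i c ⊥f h lc = tt
  stratF-open Δ i c (¬f φ) h lc = stratF-open Δ i c φ h lc
  stratF-open Δ i c (φ ∧f ψ) (h₁ , h₂) lc = stratF-open Δ i c φ h₁ lc , stratF-open Δ i c ψ h₂ lc
  stratF-open Δ i c (∀f j φ) h lc = stratF-open (j ∷ Δ) i c φ h lc
  stratF-open Δ i c (s ∈f t) (h₁ , h₂ , j , e₁ , e₂) lc =
    stratT-open Δ i c s h₁ lc , stratT-open Δ i c t h₂ lc , j , lvT-open Δ i c s e₁ lc , lvT-open Δ i c t e₂ lc

  stratT-open : ∀ Δ i c t → StratT (Δ ++ i ∷ []) t → level c ≡ i → StratT Δ (openT (length Δ) c t)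
  stratT-open Δ i c (var v) (l , e) lc = l , lvV-open Δ i c v e lc
  stratT-open Δ i c (cmp j φ) h lc = stratF-open (j ∷ Δ) i c φ h lc

mutual
  openF-out-of-scope : ∀ Γ k c φ → StratF Γ φ → length Γ ≤ k → openF k c φ ≡ φ
  openF-out-of-scope Γ k c ⊥f h le = refl
  openF-out-of-scope Γ k c (¬f φ) h le = cong ¬f (openF-out-of-scope Γ k c φ h le)
  openF-out-of-scope Γ k c (φ ∧f ψ) (h₁ , h₂) le =
    cong₂ _∧f_ (openF-out-of-scope Γ k c φ h₁ le) (openF-out-of-scope Γ k c ψ h₂ le)
  openF-out-of-scope Γ k c (∀f i φ) h le = cong (∀f i) (openF-out-of-scope (i ∷ Γ) (suc k) c φ h (s≤s le))
  openF-out-of-scope Γ k c (s ∈f t) (h₁ , h₂ , _) le =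
    cong₂ _∈f_ (openT-out-of-scope Γ k c s h₁ le) (openT-out-of-scope Γ k c t h₂ le)

  openT-out-of-scope : ∀ Γ k c t → StratT Γ t → length Γ ≤ k → openT k c t ≡ t
  openT-out-of-scope Γ k c (var v) (l , e) le = cong var (openV-out-of-scope Γ k c v e le)
  openT-out-of-scope Γ k c (cmp j φ) h le = cong (cmp j) (openF-out-of-scope (j ∷ Γ) (suc k) c φ h (s≤s le))

substV-neq : ∀ {b c} s → c ≢ b → substV b s (fr c) ≡ var (fr c)
substV-neq {b} {c} s ne with c ≟A b
... | yes e = ⊥-elim (ne e)
... | no _ = refl

module _ (b : Atom) (t : Tm) (t-closed : ∀ k c → openT k c t ≡ t) where
  openV-subst : ∀ k a v → a ≢ b → openT k a (substV b t v) ≡ substV b t (openV k a v)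
  openV-subst k a (fr c) a≢b with c ≟A b
  ... | yes _ = t-closed k a
  ... | no _ = refl
  openV-subst k a (bd n) a≢b with k ℕ.≟ n
  ... | yes _ = sym (substV-neq t a≢b)
  ... | no _ = refl

  mutual
    openF-subst : ∀ k a φ → a ≢ b → openF k a (substF b t φ) ≡ substF b t (openF k a φ)
    openF-subst k a ⊥f a≢b = refl
    openF-subst k a (¬f φ) a≢b = cong ¬f (openF-subst k a φ a≢b)
    openF-subst k a (φ ∧f ψ) a≢b = cong₂ _∧f_ (openF-subst k a φ a≢b) (openF-subst k a ψ a≢b)
    openF-subst k a (∀f i φ) a≢b = cong (∀f i) (openF-subst (suc k) a φ a≢b)
    openF-subst k a (s ∈f u) a≢b = cong₂ _∈f_ (openT-subst k a s a≢b) (openT-subst k a u a≢b)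

    openT-subst : ∀ k a s → a ≢ b → openT k a (substT b t s) ≡ substT b t (openT k a s)
    openT-subst k a (var v) a≢b = openV-subst k a v a≢b
    openT-subst k a (cmp j φ) a≢b = cong (cmp j) (openF-subst (suc k) a φ a≢b)

mutual
  sizeF : Fm → ℕ
  sizeF ⊥f = 0
  sizeF (¬f φ) = suc (sizeF φ)
  sizeF (φ ∧f ψ) = suc (sizeF φ + sizeF ψ)
  sizeF (∀f i φ) = suc (sizeF φ)
  sizeF (s ∈f t) = suc (sizeT s + sizeT t)

  sizeT : Tm → ℕ
  sizeT (var v) = 0
  sizeT (cmp j φ) = suc (sizeF φ)

mutual
  sizeF-open : ∀ k c φ → sizeF (openF k c φ) ≡ sizeF φ
  sizeF-open k c ⊥f = refl
  sizeF-open k c (¬f φ) = cong suc (sizeF-open k c φ)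
  sizeF-open k c (φ ∧f ψ) = cong suc (cong₂ _+_ (sizeF-open k c φ) (sizeF-open k c ψ))
  sizeF-open k c (∀f i φ) = cong suc (sizeF-open (suc k) c φ)
  sizeF-open k c (s ∈f t) = cong suc (cong₂ _+_ (sizeT-open k c s) (sizeT-open k c t))

  sizeT-open : ∀ k c t → sizeT (openT k c t) ≡ sizeT t
  sizeT-open k c (var v) = refl
  sizeT-open k c (cmp j φ) = cong suc (sizeF-open (suc k) c φ)

sizeF-open≤ : ∀ {s} c φ → sizeF φ ≤ s → sizeF (openF 0 c φ) ≤ s
sizeF-open≤ c φ h = subst (_≤ _) (sym (sizeF-open 0 c φ)) h

-- Everything below is relative to a floor m: well-typed syntax has all set levels ≥ m, so the rank
-- level - m of an atom is a natural number that strictly decreases from a set to its elements.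
module Floor (m : ℤ) where

  mutual
    TyS : List ℤ → St → ℤ → Set
    TyS Γ (atm v) i = lvV Γ v ≡ just i × m ℤ.≤ i
    TyS Γ (st j X) i = i ≡ j ℤ.+ + 1 × m ℤ.≤ j × TyP (j ∷ Γ) X

    TyP : List ℤ → Pr → Set
    TyP Γ (and Xs) = TyL Γ Xs
    TyP Γ (neg X) = TyP Γ X
    TyP Γ (all i X) = TyP (i ∷ Γ) X
    TyP Γ (elt y v) = ∃[ i ] (TyS Γ y i × lvV Γ v ≡ just (i ℤ.+ + 1))

    TyL : List ℤ → List Pr → Set
    TyL Γ [] = ⊤
    TyL Γ (X ∷ Xs) = TyP Γ X × TyL Γ Xs

  mutual
    tyP-open : ∀ Δ i c Z → TyP (Δ ++ i ∷ []) Z → level c ≡ i → TyP Δ (openP (length Δ) c Z)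
    tyP-open Δ i c (and Xs) h lc = tyL-open Δ i c Xs h lc
    tyP-open Δ i c (neg X) h lc = tyP-open Δ i c X h lc
    tyP-open Δ i c (all j X) h lc = tyP-open (j ∷ Δ) i c X h lc
    tyP-open Δ i c (elt y v) (l , hy , hv) lc = l , tyS-open Δ i c y hy lc , lvV-open Δ i c v hv lc

    tyL-open : ∀ Δ i c Xs → TyL (Δ ++ i ∷ []) Xs → level c ≡ i → TyL Δ (openL (length Δ) c Xs)
    tyL-open Δ i c [] h lc = tt
    tyL-open Δ i c (X ∷ Xs) (h1 , h2) lc = tyP-open Δ i c X h1 lc , tyL-open Δ i c Xs h2 lc

    tyS-open : ∀ Δ i c z {l} → TyS (Δ ++ i ∷ []) z l → level c ≡ i → TyS Δ (openS (length Δ) c z) l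
    tyS-open Δ i c (atm v) (h1 , h2) lc = lvV-open Δ i c v h1 lc , h2
    tyS-open Δ i c (st j X) (h1 , h2 , h3) lc = h1 , h2 , tyP-open (j ∷ Δ) i c X h3 lc

  mutual
    tyP-close : ∀ Δ c Z → TyP Δ Z → TyP (Δ ++ level c ∷ []) (closeP (length Δ) c Z)
    tyP-close Δ c (and Xs) h = tyL-close Δ c Xs h
    tyP-close Δ c (neg X) h = tyP-close Δ c X h
    tyP-close Δ c (all j X) h = tyP-close (j ∷ Δ) c X h
    tyP-close Δ c (elt y v) (l , hy , hv) = l , tyS-close Δ c y hy , lvV-close Δ c v hv

    tyL-close : ∀ Δ c Xs → TyL Δ Xs → TyL (Δ ++ level c ∷ []) (closeL (length Δ) c Xs)
    tyL-close Δ c [] h = tt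
    tyL-close Δ c (X ∷ Xs) (h1 , h2) = tyP-close Δ c X h1 , tyL-close Δ c Xs h2

    tyS-close : ∀ Δ c z {l} → TyS Δ z l → TyS (Δ ++ level c ∷ []) (closeS (length Δ) c z) l
    tyS-close Δ c (atm v) (h1 , h2) = lvV-close Δ c v h1 , h2
    tyS-close Δ c (st j X) (h1 , h2 , h3) = h1 , h2 , tyP-close (j ∷ Δ) c X h3

  mutual
    openP-closeP : ∀ Δ c Z → TyP Δ Z → openP (length Δ) c (closeP (length Δ) c Z) ≡ Z
    openP-closeP Δ c (and Xs) h = cong and (openL-closeL Δ c Xs h)
    openP-closeP Δ c (neg X) h = cong neg (openP-closeP Δ c X h)
    openP-closeP Δ c (all j X) h = cong (all j) (openP-closeP (j ∷ Δ) c X h)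
    openP-closeP Δ c (elt y v) (l , hy , hv) = cong₂ elt (openS-closeS Δ c y hy) (openV-closeV Δ c v hv)

    openL-closeL : ∀ Δ c Xs → TyL Δ Xs → openL (length Δ) c (closeL (length Δ) c Xs) ≡ Xs
    openL-closeL Δ c [] h = refl
    openL-closeL Δ c (X ∷ Xs) (h1 , h2) = cong₂ _∷_ (openP-closeP Δ c X h1) (openL-closeL Δ c Xs h2)

    openS-closeS : ∀ Δ c z {l} → TyS Δ z l → openS (length Δ) c (closeS (length Δ) c z) ≡ z
    openS-closeS Δ c (atm v) (h1 , h2) = cong atm (openV-closeV Δ c v h1)
    openS-closeS Δ c (st j X) (h1 , h2 , h3) = cong (st j) (openP-closeP (j ∷ Δ) c X h3)

  tyP-open₀ : ∀ {i} c Z → TyP (i ∷ []) Z → level c ≡ i → TyP [] (openP 0 c Z)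
  tyP-open₀ {i} c Z h lc = tyP-open [] i c Z h lc

  tyP-close₀ : ∀ c Z → TyP [] Z → TyP (level c ∷ []) (closeP 0 c Z)
  tyP-close₀ c Z h = tyP-close [] c Z h

  openP-closeP₀ : ∀ c Z → TyP [] Z → openP 0 c (closeP 0 c Z) ≡ Z
  openP-closeP₀ c Z h = openP-closeP [] c Z h

  rank : ℤ → ℕ
  rank j = ℤ.∣ j ℤ.- m ∣

  rank-suc : ∀ {j} → m ℤ.≤ j → rank (j ℤ.+ + 1) ≡ suc (rank j)
  rank-suc {j} m≤j = begin
    ℤ.∣ (j ℤ.+ + 1) ℤ.- m ∣    ≡⟨ cong ℤ.∣_∣ (ℤP.+-assoc j (+ 1) (ℤ.- m)) ⟩
    ℤ.∣ j ℤ.+ (+ 1 ℤ.- m) ∣    ≡⟨ cong (λ z → ℤ.∣ j ℤ.+ z ∣) (ℤP.+-comm (+ 1) (ℤ.- m)) ⟩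
    ℤ.∣ j ℤ.+ (ℤ.- m ℤ.+ + 1) ∣ ≡⟨ cong ℤ.∣_∣ (sym (ℤP.+-assoc j (ℤ.- m) (+ 1))) ⟩
    ℤ.∣ (j ℤ.- m) ℤ.+ + 1 ∣    ≡⟨ cong (λ z → ℤ.∣ z ℤ.+ + 1 ∣) (sym (ℤP.0≤i⇒+∣i∣≡i (ℤP.i≤j⇒0≤j-i m≤j))) ⟩
    ℤ.∣ (+ rank j) ℤ.+ + 1 ∣   ≡⟨ ℕP.+-comm (rank j) 1 ⟩
    suc (rank j)               ∎
    where open ≡-Reasoning

  -- A σ-action on the elements of a set of level j + 1 needs one unit of rank budget less.
  rank-budget : ∀ {i j r} → i ≡ j ℤ.+ + 1 → m ℤ.≤ j → rank i ≤ suc r → rank j ≤ r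
  rank-budget refl m≤j hr = ℕP.≤-pred (subst (_≤ _) (rank-suc m≤j) hr)

  rank-positive : ∀ {i j} → i ≡ j ℤ.+ + 1 → m ℤ.≤ j → rank i ≤ zero → ⊥
  rank-positive refl m≤j hr with () ← subst (_≤ zero) (rank-suc m≤j) hr

  mutual
    sizeP : Pr → ℕ
    sizeP (and Xs) = suc (sizeL Xs)
    sizeP (neg X) = suc (sizeP X)
    sizeP (all i X) = suc (sizeP X)
    sizeP (elt y v) = suc (sizeS y)

    sizeL : List Pr → ℕ
    sizeL [] = 0
    sizeL (X ∷ Xs) = sizeP X + sizeL Xs

    sizeS : St → ℕ
    sizeS (atm v) = 0
    sizeS (st j X) = suc (sizeP X)

  mutual
    sizeP-open : ∀ k c Z → sizeP (openP k c Z) ≡ sizeP Z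
    sizeP-open k c (and Xs) = cong suc (sizeL-open k c Xs)
    sizeP-open k c (neg X) = cong suc (sizeP-open k c X)
    sizeP-open k c (all i X) = cong suc (sizeP-open (suc k) c X)
    sizeP-open k c (elt y v) = cong suc (sizeS-open k c y)

    sizeL-open : ∀ k c Xs → sizeL (openL k c Xs) ≡ sizeL Xs
    sizeL-open k c [] = refl
    sizeL-open k c (X ∷ Xs) = cong₂ _+_ (sizeP-open k c X) (sizeL-open k c Xs)

    sizeS-open : ∀ k c z → sizeS (openS k c z) ≡ sizeS z
    sizeS-open k c (atm v) = refl
    sizeS-open k c (st j X) = cong suc (sizeP-open (suc k) c X)

  sizeP-open≤ : ∀ {s} c X → sizeP X ≤ s → sizeP (openP 0 c X) ≤ s
  sizeP-open≤ c X h = subst (_≤ _) (sym (sizeP-open 0 c X)) h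

  level-pred : ∀ {i l j} → just i ≡ just (l ℤ.+ + 1) → i ≡ j ℤ.+ + 1 → l ≡ j
  level-pred {l = l} {j} hv ec = ∙-cancelʳ (+ 1) l j (trans (sym (just-injective hv)) ec)

  freshBinder : ∀ i a X x → ∃[ d ] (level d ≡ i × d ≢ a × d ∉ atomsP X × d ∉ atomsS x)
  freshBinder i a X x with pick i ((a ∷ []) ∷ atomsP X ∷ atomsS x ∷ [])
  ... | d , ld , d≢a ∷ dX ∷ dx ∷ [] = d , ld , ∉-singleton d≢a , dX , dx

  mutual
    tySigP : ∀ {Z a x W} → SigP Z a x W → TyP [] Z → TyS [] x (level a) → TyP [] W
    tySigP (sig-and D) h hx = tySigL D h hx
    tySigP (sig-neg D) h hx = tySigP D h hx
    tySigP (sig-all {X = X} {W = W} b refl _ _ _ D) h hx = tyP-close₀ b W (tySigP D (tyP-open₀ b X h refl) hx)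
    tySigP (sig-elt-atm D) (l , hy , hv) hx@(e , _) = l , tySigS D hy hx , trans e hv
    tySigP (sig-elt-st {X' = X'} a' refl _ _ _ Dy DW) (l , hy , hv) hx@(ea , _ , hX) =
      tySigP DW (tyP-open₀ a' X' hX refl) (subst (TyS [] _) (level-pred hv ea) (tySigS Dy hy hx))
    tySigP (sig-elt-oth _ D) (l , hy , hv) hx = l , tySigS D hy hx , hv

    tySigL : ∀ {Xs a x Ys} → SigL Xs a x Ys → TyL [] Xs → TyS [] x (level a) → TyL [] Ys
    tySigL sigL-[] h hx = tt
    tySigL (sigL-∷ D E) (h1 , h2) hx = tySigP D h1 hx , tySigL E h2 hx

    tySigS : ∀ {z a x w i} → SigS z a x w → TyS [] z i → TyS [] x (level a) → TyS [] w i
    tySigS sig-atm-eq (e , _) hx = subst (TyS [] _) (just-injective e) hx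
    tySigS (sig-atm-neq _) h hx = h
    tySigS (sig-st {X = X} {W = W} c refl _ _ _ D) (e , mj , h) hx =
      e , mj , tyP-close₀ c W (tySigP D (tyP-open₀ c X h refl) hx)

  -- Totality: on well-typed syntax Z[a ↦ x] is defined.  Induction on the rank of a (the clause
  -- elt(y,a)[a ↦ st([a']X')] recurses into X' with a' one level lower), then on the size of Z.
  mutual
    totP : ∀ r s {a x} Z → TyP [] Z → TyS [] x (level a) → rank (level a) ≤ r → sizeP Z ≤ s →
           ∃ λ W → SigP Z a x W
    totP r (suc s) (and Xs) h hx hr (s≤s hs) with totL r s Xs h hx hr hs
    ... | Ys , D = and Ys , sig-and D
    totP r (suc s) (neg X) h hx hr (s≤s hs) with totP r s X h hx hr hs
    ... | W , D = neg W , sig-neg D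
    totP r (suc s) {a} {x} (all i X) h hx hr (s≤s hs) with freshBinder i a X x
    ... | d , ld , d≢a , dX , dx with totP r s (openP 0 d X) (tyP-open₀ d X h ld) hx hr (sizeP-open≤ d X hs)
    ...   | W , D = all i (closeP 0 d W) , sig-all d ld d≢a dX dx D
    totP r (suc s) (elt y (bd n)) (l , hy , ()) hx hr (s≤s hs)
    totP r (suc s) {a} {x} (elt y (fr c)) (l , hy , hv) hx hr (s≤s hs) with c ≟A a
    ... | no c≢a with totS r s y hy hx hr hs
    ...   | y' , D = elt y' (fr c) , sig-elt-oth c≢a D
    totP r (suc s) {a} {atm (fr n)} (elt y (fr c)) (l , hy , hv) hx hr (s≤s hs) | yes refl
      with totS r s y hy hx hr hs
    ... | y' , D = elt y' (fr n) , sig-elt-atm D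
    totP r (suc s) {a} {atm (bd n)} (elt y (fr c)) (l , hy , hv) (() , _) hr (s≤s hs) | yes refl
    totP r (suc s) {a} {st j X'} (elt y (fr c)) (l , hy , hv) hx hr (s≤s hs) | yes refl =
      totEltSt r s y X' hy hv hx hr hs

    -- elt(y,c)[c ↦ st([d]X')] = X'[d ↦ y[c ↦ st([d]X')]]: the outer σ-action is at lower rank
    totEltSt : ∀ r s {c l j} y X' → TyS [] y l → just (level c) ≡ just (l ℤ.+ + 1) →
               TyS [] (st j X') (level c) → rank (level c) ≤ r → sizeS y ≤ s →
               ∃ λ W → SigP (elt y (fr c)) c (st j X') W
    totEltSt zero s y X' hy hv (ea , mj , hX) hr hs = ⊥-elim (rank-positive ea mj hr)
    totEltSt (suc r) s {c} {l} {j} y X' hy hv hx@(ea , mj , hX) hr hs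
      with totS (suc r) s {c} {st j X'} y hy hx hr hs | freshBinder j c X' y
    ... | Y , Dy | d , ld , d≢c , dX , dy
      with totP r _ (openP 0 d X') (tyP-open₀ d X' hX ld)
             (subst (TyS [] Y) (trans (level-pred hv ea) (sym ld)) (tySigS Dy hy hx))
             (subst (λ k → rank k ≤ r) (sym ld) (rank-budget ea mj hr)) ℕP.≤-refl
    ...   | W , DW = W , sig-elt-st d ld d≢c dX dy Dy DW

    totL : ∀ r s {a x} Xs → TyL [] Xs → TyS [] x (level a) → rank (level a) ≤ r → sizeL Xs ≤ s →
           ∃ λ Ys → SigL Xs a x Ys
    totL r s [] h hx hr hs = [] , sigL-[]
    totL r s (X ∷ Xs) (h1 , h2) hx hr hs
      with totP r s X h1 hx hr (ℕP.m+n≤o⇒m≤o (sizeP X) hs) | totL r s Xs h2 hx hr (ℕP.m+n≤o⇒n≤o (sizeP X) hs)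
    ... | Y , D | Ys , E = Y ∷ Ys , sigL-∷ D E

    totS : ∀ r s {a x} z {i} → TyS [] z i → TyS [] x (level a) → rank (level a) ≤ r → sizeS z ≤ s →
           ∃ λ w → SigS z a x w
    totS r s (atm (bd n)) (() , _) hx hr hs
    totS r s {a} {x} (atm (fr c)) h hx hr hs with c ≟A a
    ... | yes refl = x , sig-atm-eq
    ... | no c≢a = atm (fr c) , sig-atm-neq c≢a
    totS r (suc s) {a} {x} (st j X) (e , mj , h) hx hr (s≤s hs) with freshBinder j a X x
    ... | d , ld , d≢a , dX , dx with totP r s (openP 0 d X) (tyP-open₀ d X h ld) hx hr (sizeP-open≤ d X hs)
    ...   | W , D = st j (closeP 0 d W) , sig-st d ld d≢a dX dx D

  totalSigP : ∀ {a x} Z → TyP [] Z → TyS [] x (level a) → ∃ λ W → SigP Z a x W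
  totalSigP Z h hx = totP _ _ Z h hx ℕP.≤-refl ℕP.≤-refl

  totalSigS : ∀ {a x} z {i} → TyS [] z i → TyS [] x (level a) → ∃ λ w → SigS z a x w
  totalSigS z h hx = totS _ _ z h hx ℕP.≤-refl ℕP.≤-refl

  -- Determinism: on well-typed syntax Z[a ↦ x] has at most one value.  Same induction as
  -- totality; in binder clauses both derivations are first renamed to a common fresh atom.
  mutual
    detP : ∀ r s {Z a x W₁ W₂} → TyP [] Z → TyS [] x (level a) → rank (level a) ≤ r → sizeP Z ≤ s →
           SigP Z a x W₁ → SigP Z a x W₂ → W₁ ≡ W₂
    detP r (suc s) h hx hr (s≤s hs) (sig-and D₁) (sig-and D₂) = cong and (detL r s h hx hr hs D₁ D₂)
    detP r (suc s) h hx hr (s≤s hs) (sig-neg D₁) (sig-neg D₂) = cong neg (detP r s h hx hr hs D₁ D₂)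
    detP r (suc s) {all i X} {a} {x} h hx hr (s≤s hs) D₁@(sig-all _ _ _ _ _ _) D₂ with freshBinder i a X x
    ... | d , ld , d≢a , dX , dx with renameSigAll D₁ d ld d≢a dX dx | renameSigAll D₂ d ld d≢a dX dx
    ...   | W₁ , E₁ , e₁ | W₂ , E₂ , e₂ =
      trans e₁ (trans (cong (λ W → all i (closeP 0 d W))
        (detP r s (tyP-open₀ d X h ld) hx hr (sizeP-open≤ d X hs) E₁ E₂)) (sym e₂))
    detP r (suc s) (l , hy , hv) hx hr (s≤s hs) (sig-elt-atm E₁) (sig-elt-atm E₂) =
      cong (λ y → elt y _) (detS r s hy hx hr hs E₁ E₂)
    detP r (suc s) h hx hr (s≤s hs) (sig-elt-atm E₁) (sig-elt-oth ne E₂) = ⊥-elim (ne refl)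
    detP r (suc s) (l , hy , hv) hx hr (s≤s hs) D₁@(sig-elt-st _ _ _ _ _ _ _) D₂ = detEltSt r s hy hv hx hr hs D₁ D₂
    detP r (suc s) h hx hr (s≤s hs) (sig-elt-oth ne E₁) (sig-elt-atm E₂) = ⊥-elim (ne refl)
    detP r (suc s) h hx hr (s≤s hs) (sig-elt-oth ne E₁) (sig-elt-st _ _ _ _ _ _ _) = ⊥-elim (ne refl)
    detP r (suc s) (l , hy , hv) hx hr (s≤s hs) (sig-elt-oth _ E₁) (sig-elt-oth _ E₂) =
      cong (λ y → elt y _) (detS r s hy hx hr hs E₁ E₂)

    -- elt(y,c)[c ↦ st([d]X')] = X'[d ↦ y[c ↦ st([d]X')]]: the inner σ-action is at lower rank
    detEltSt : ∀ r s {c l j y X' R₁ R₂} → TyS [] y l → just (level c) ≡ just (l ℤ.+ + 1) →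
               TyS [] (st j X') (level c) → rank (level c) ≤ r → sizeS y ≤ s →
               SigP (elt y (fr c)) c (st j X') R₁ → SigP (elt y (fr c)) c (st j X') R₂ → R₁ ≡ R₂
    detEltSt zero s hy hv (ea , mj , hX) hr hs D₁ D₂ = ⊥-elim (rank-positive ea mj hr)
    detEltSt (suc r) s {c} {l} {j} {y} {X'} hy hv hx@(ea , mj , hX) hr hs D₁ D₂ =
      let (d , ld , d≢c , dX , dy) = freshBinder j c X' y
          (Y , DY₁ , DW₁) = renameSigEltSt D₁ d ld d≢c dX dy
          (Y₂ , DY₂ , DW₂) = renameSigEltSt D₂ d ld d≢c dX dy
      in detP r _ (tyP-open₀ d X' hX ld) (subst (TyS [] Y) (trans (level-pred hv ea) (sym ld)) (tySigS DY₁ hy hx))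
           (subst (λ k → rank k ≤ r) (sym ld) (rank-budget ea mj hr)) ℕP.≤-refl DW₁
           (subst (λ Y' → SigP (openP 0 d X') d Y' _) (detS (suc r) s hy hx hr hs DY₂ DY₁) DW₂)

    detL : ∀ r s {Xs a x Ys₁ Ys₂} → TyL [] Xs → TyS [] x (level a) → rank (level a) ≤ r → sizeL Xs ≤ s →
           SigL Xs a x Ys₁ → SigL Xs a x Ys₂ → Ys₁ ≡ Ys₂
    detL r s h hx hr hs sigL-[] sigL-[] = refl
    detL r s {X ∷ Xs} (h1 , h2) hx hr hs (sigL-∷ D₁ E₁) (sigL-∷ D₂ E₂) =
      cong₂ _∷_ (detP r s h1 hx hr (ℕP.m+n≤o⇒m≤o (sizeP X) hs) D₁ D₂)
                (detL r s h2 hx hr (ℕP.m+n≤o⇒n≤o (sizeP X) hs) E₁ E₂)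

    detS : ∀ r s {z a x w₁ w₂ i} → TyS [] z i → TyS [] x (level a) → rank (level a) ≤ r → sizeS z ≤ s →
           SigS z a x w₁ → SigS z a x w₂ → w₁ ≡ w₂
    detS r s h hx hr hs sig-atm-eq sig-atm-eq = refl
    detS r s h hx hr hs sig-atm-eq (sig-atm-neq ne) = ⊥-elim (ne refl)
    detS r s h hx hr hs (sig-atm-neq ne) sig-atm-eq = ⊥-elim (ne refl)
    detS r s h hx hr hs (sig-atm-neq ne) (sig-atm-neq _) = refl
    detS r (suc s) {st j X} {a} {x} (e , mj , h) hx hr (s≤s hs) D₁@(sig-st _ _ _ _ _ _) D₂ with freshBinder j a X x
    ... | d , ld , d≢a , dX , dx with renameSigSt D₁ d ld d≢a dX dx | renameSigSt D₂ d ld d≢a dX dx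
    ...   | W₁ , E₁ , e₁ | W₂ , E₂ , e₂ =
      trans e₁ (trans (cong (λ W → st j (closeP 0 d W))
        (detP r s (tyP-open₀ d X h ld) hx hr (sizeP-open≤ d X hs) E₁ E₂)) (sym e₂))

  detSigP : ∀ {Z a x W₁ W₂} → TyP [] Z → TyS [] x (level a) → SigP Z a x W₁ → SigP Z a x W₂ → W₁ ≡ W₂
  detSigP {Z} h hx = detP _ (sizeP Z) h hx ℕP.≤-refl ℕP.≤-refl

  detSigS : ∀ {z a x w₁ w₂ i} → TyS [] z i → TyS [] x (level a) → SigS z a x w₁ → SigS z a x w₂ → w₁ ≡ w₂
  detSigS {z} h hx = detS _ (sizeS z) h hx ℕP.≤-refl ℕP.≤-refl

  mutual
    idP : ∀ s {a x} Z → TyP [] Z → a ∉ atomsP Z → sizeP Z ≤ s → SigP Z a x Z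
    idP (suc s) (and Xs) h ha (s≤s hs) = sig-and (idL s Xs h ha hs)
    idP (suc s) (neg X) h ha (s≤s hs) = sig-neg (idP s X h ha hs)
    idP (suc s) {a} {x} (all i X) h ha (s≤s hs) with freshBinder i a X x
    ... | d , ld , d≢a , dX , dx =
      subst (λ X' → SigP (all i X) a x (all i X')) (closeP-openP 0 d X dX)
        (sig-all d ld d≢a dX dx
          (idP s (openP 0 d X) (tyP-open₀ d X h ld) (∉-open 0 d X ha (λ e → d≢a (sym e))) (sizeP-open≤ d X hs)))
    idP (suc s) (elt y (bd n)) (l , hy , ()) ha (s≤s hs)
    idP (suc s) (elt y (fr c)) (l , hy , hv) ha (s≤s hs) =
      sig-elt-oth (λ e → ha (∈-++⁺ʳ (atomsS y) (here (sym e)))) (idS s y hy (∉-++ˡ ha) hs)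

    idL : ∀ s {a x} Xs → TyL [] Xs → a ∉ atomsL Xs → sizeL Xs ≤ s → SigL Xs a x Xs
    idL s [] h ha hs = sigL-[]
    idL s (X ∷ Xs) (h1 , h2) ha hs =
      sigL-∷ (idP s X h1 (∉-++ˡ ha) (ℕP.m+n≤o⇒m≤o (sizeP X) hs))
             (idL s Xs h2 (∉-++ʳ (atomsP X) ha) (ℕP.m+n≤o⇒n≤o (sizeP X) hs))

    idS : ∀ s {a x} z {i} → TyS [] z i → a ∉ atomsS z → sizeS z ≤ s → SigS z a x z
    idS s (atm (bd n)) (() , _) ha hs
    idS s (atm (fr c)) h ha hs = sig-atm-neq (λ e → ha (here (sym e)))
    idS (suc s) {a} {x} (st j X) (e , mj , h) ha (s≤s hs) with freshBinder j a X x
    ... | d , ld , d≢a , dX , dx =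
      subst (λ X' → SigS (st j X) a x (st j X')) (closeP-openP 0 d X dX)
        (sig-st d ld d≢a dX dx
          (idP s (openP 0 d X) (tyP-open₀ d X h ld) (∉-open 0 d X ha (λ e → d≢a (sym e))) (sizeP-open≤ d X hs)))

  idSigP : ∀ {a x} Z → TyP [] Z → a ∉ atomsP Z → SigP Z a x Z
  idSigP Z h ha = idP (sizeP Z) Z h ha ℕP.≤-refl

  idSigS : ∀ {a x} z {i} → TyS [] z i → a ∉ atomsS z → SigS z a x z
  idSigS z h ha = idS (sizeS z) z h ha ℕP.≤-refl

  invEltOther : ∀ {w v a x Y} → SigP (elt w (fr v)) a x Y → v ≢ a → ∃ λ w' → SigS w a x w' × Y ≡ elt w' (fr v)
  invEltOther (sig-elt-atm _) ne = ⊥-elim (ne refl)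
  invEltOther (sig-elt-st _ _ _ _ _ _ _) ne = ⊥-elim (ne refl)
  invEltOther (sig-elt-oth _ E) ne = _ , E , refl

  invEltAtm : ∀ {w a n Y} → SigP (elt w (fr a)) a (atm (fr n)) Y →
              ∃ λ w' → SigS w a (atm (fr n)) w' × Y ≡ elt w' (fr n)
  invEltAtm (sig-elt-atm E) = _ , E , refl
  invEltAtm (sig-elt-oth ne E) = ⊥-elim (ne refl)

  invAtmSelf : ∀ {a x w} → SigS (atm (fr a)) a x w → w ≡ x
  invAtmSelf sig-atm-eq = refl
  invAtmSelf (sig-atm-neq ne) = ⊥-elim (ne refl)

  invAtmOther : ∀ {v a x w} → SigS (atm (fr v)) a x w → v ≢ a → w ≡ atm (fr v)
  invAtmOther sig-atm-eq ne = ⊥-elim (ne refl)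
  invAtmOther (sig-atm-neq _) ne = refl

  -- The measure of the commutation lemma drops when c (resp. b) is replaced by an element of
  -- the set substituted for it.
  rank-sum-right : ∀ R {i k j} → rank i + rank k ≤ R → k ≡ j ℤ.+ + 1 → m ℤ.≤ j → rank i + rank j < R
  rank-sum-right R {i} hR refl m≤j = subst (_≤ R) (trans (cong (λ n → rank i + n) (rank-suc m≤j)) (ℕP.+-suc (rank i) _)) hR

  rank-sum-left : ∀ R {i k e} → rank i + rank k ≤ R → i ≡ e ℤ.+ + 1 → m ℤ.≤ e → rank k + rank e < R
  rank-sum-left R {k = k} {e} hR refl m≤e =
    subst (_≤ R) (trans (cong (_+ rank k) (rank-suc m≤e)) (cong suc (ℕP.+-comm (rank e) (rank k)))) hR

  -- The five derivations are, in order,  Z[c↦y₀] = X,  y₀[b↦T] = y₁,  Z[b↦T] = Z₁,  Z₁[c↦y₁] = Y  and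
  -- X[b↦T] = X';  the conclusion is X' = Y.  Induction on rank(b) + rank(c), then on the size of Z:
  -- when c (or b) meets a comprehension the lemma is reused at an element level of it.
  mutual
    commP : ∀ R s {Z c y₀ b T X y₁ Z₁ Y X'} → c ≢ b → c ∉ atomsS T →
            TyP [] Z → TyS [] y₀ (level c) → TyS [] T (level b) →
            rank (level b) + rank (level c) ≤ R → sizeP Z ≤ s →
            SigP Z c y₀ X → SigS y₀ b T y₁ → SigP Z b T Z₁ → SigP Z₁ c y₁ Y → SigP X b T X' → X' ≡ Y
    commP R (suc s) c≢b cT hZ hy₀ hT hR (s≤s hs) (sig-and L₁) D₂ (sig-and L₃) (sig-and L₄) (sig-and L₅) =
      cong and (commL R s c≢b cT hZ hy₀ hT hR hs L₁ D₂ L₃ L₄ L₅)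
    commP R (suc s) c≢b cT hZ hy₀ hT hR (s≤s hs) (sig-neg L₁) D₂ (sig-neg L₃) (sig-neg L₄) (sig-neg L₅) =
      cong neg (commP R s c≢b cT hZ hy₀ hT hR hs L₁ D₂ L₃ L₄ L₅)
    commP R (suc s) {all i U} {c} {y₀} {b} {T} {y₁ = y₁} c≢b cT hZ hy₀ hT hR (s≤s hs)
          D₁@(sig-all _ _ _ _ _ _) D₂ D₃ D₄ D₅ =
      commAll R s c≢b cT hZ hy₀ hT hR hs D₁ D₂ D₃ D₄ D₅
        (pick i ((c ∷ []) ∷ (b ∷ []) ∷ atomsP U ∷ atomsS y₀ ∷ atomsS T ∷ atomsS y₁ ∷ []))
    commP R (suc s) c≢b cT (l , hw , hv) hy₀ hT hR (s≤s hs) (sig-elt-atm E₁) (sig-atm-neq n≢b) D₃ D₄ D₅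
      with invEltOther D₃ c≢b
    ... | w₁ , E₃ , refl with invEltAtm D₄ | invEltOther D₅ n≢b
    ...   | _ , E₄ , refl | _ , E₅ , refl =
      cong (λ z → elt z _) (commS R s c≢b cT hw hy₀ hT hR hs E₁ (sig-atm-neq n≢b) E₃ E₄ E₅)
    commP R (suc s) c≢b cT (l , hw , hv) hy₀ hT hR (s≤s hs) (sig-elt-atm E₁) sig-atm-eq D₃ D₄ D₅
      with invEltOther D₃ c≢b
    ... | w₁ , E₃ , refl = commEltAtm R s c≢b cT hw hv hy₀ hT hR hs E₁ E₃ D₄ D₅
    commP R (suc s) {b = b} {T = T} c≢b cT (l , hw , hv) hy₀ hT hR (s≤s hs)
          D₁@(sig-elt-st {y = w} {a = c} {j} {U} _ _ _ _ _ _ _) D₂ D₃ D₄ D₅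
      with invEltOther D₃ c≢b
    ... | w₁ , E₃ , refl =
      commEltSt R s c≢b cT hw hv hy₀ hT hR hs D₁ D₂ E₃ D₄ D₅
        (pick j ((c ∷ []) ∷ (b ∷ []) ∷ atomsP U ∷ atomsS w ∷ atomsS T ∷ atomsS w₁ ∷ []))
    commP R (suc s) c≢b cT (l , hw , hv) hy₀ hT hR (s≤s hs) (sig-elt-oth v≢c E₁) D₂ (sig-elt-oth v≢b E₃) D₄ D₅
      with invEltOther D₄ v≢c | invEltOther D₅ v≢b
    ... | _ , E₄ , refl | _ , E₅ , refl =
      cong (λ z → elt z _) (commS R s c≢b cT hw hy₀ hT hR hs E₁ D₂ E₃ E₄ E₅)
    commP R (suc s) c≢b cT (l , hw , hv) hy₀ hT hR (s≤s hs) (sig-elt-oth v≢c E₁) D₂ (sig-elt-atm E₃) D₄ D₅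
      with invEltOther D₄ (λ e → cT (here (sym e))) | invEltAtm D₅
    ... | _ , E₄ , refl | _ , E₅ , refl =
      cong (λ z → elt z _) (commS R s c≢b cT hw hy₀ hT hR hs E₁ D₂ E₃ E₄ E₅)
    commP R (suc s) {c = c} {b = b} {T = st e V} {y₁ = y₁} c≢b cT (l , hw , hv) hy₀ hT hR (s≤s hs)
          (sig-elt-oth {y = w} {y' = w'} v≢c E₁) D₂ D₃@(sig-elt-st _ _ _ _ _ _ _) D₄ D₅ =
      commEltB R s c≢b cT hw hv hy₀ hT hR hs E₁ D₂ D₃ D₄ D₅
        (pick e ((c ∷ []) ∷ (b ∷ []) ∷ atomsP V ∷ atomsS w ∷ atomsS w' ∷ atomsS y₁ ∷ []))

    commP-< : ∀ R s {Z c y₀ b T X y₁ Z₁ Y X'} → c ≢ b → c ∉ atomsS T →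
              TyP [] Z → TyS [] y₀ (level c) → TyS [] T (level b) →
              rank (level b) + rank (level c) < R → sizeP Z ≤ s →
              SigP Z c y₀ X → SigS y₀ b T y₁ → SigP Z b T Z₁ → SigP Z₁ c y₁ Y → SigP X b T X' → X' ≡ Y
    commP-< (suc R) s c≢b cT hZ hy₀ hT (s≤s hR) hs D₁ D₂ D₃ D₄ D₅ =
      commP R s c≢b cT hZ hy₀ hT hR hs D₁ D₂ D₃ D₄ D₅

    -- Z = all([d]U): rename all four binder derivations to one fresh d and recurse on U opened at d
    commAll : ∀ R s {i U c y₀ b T X y₁ Z₁ Y X'} → c ≢ b → c ∉ atomsS T →
              TyP [] (all i U) → TyS [] y₀ (level c) → TyS [] T (level b) →
              rank (level b) + rank (level c) ≤ R → sizeP U ≤ s →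
              SigP (all i U) c y₀ X → SigS y₀ b T y₁ → SigP (all i U) b T Z₁ → SigP Z₁ c y₁ Y → SigP X b T X' →
              Fresh i ((c ∷ []) ∷ (b ∷ []) ∷ atomsP U ∷ atomsS y₀ ∷ atomsS T ∷ atomsS y₁ ∷ []) → X' ≡ Y
    commAll R s {i} {U} {c} {y₀} {b} {T} {y₁ = y₁} c≢b cT hZ hy₀ hT hR hs D₁ D₂ D₃ D₄ D₅
            (d , ld , dc ∷ db ∷ dU ∷ dy₀ ∷ dT ∷ dy₁ ∷ [])
      with renameSigAll D₁ d ld (∉-singleton dc) dU dy₀ | renameSigAll D₃ d ld (∉-singleton db) dU dT
    ... | W₁ , E₁ , refl | W₃ , E₃ , refl
      with renameSigAll D₄ d ld (∉-singleton dc) (∉-close-self 0 d W₃) dy₁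
         | renameSigAll D₅ d ld (∉-singleton db) (∉-close-self 0 d W₁) dT
    ...   | W₄ , E₄ , refl | W₅ , E₅ , refl =
      cong (λ W → all i (closeP 0 d W))
        (commP R s c≢b cT hU hy₀ hT hR (sizeP-open≤ d U hs) E₁ D₂ E₃
          (subst (λ Z → SigP Z c y₁ W₄) (openP-closeP₀ d W₃ (tySigP E₃ hU hT)) E₄)
          (subst (λ Z → SigP Z b T W₅) (openP-closeP₀ d W₁ (tySigP E₁ hU hy₀)) E₅))
      where
      hU : TyP [] (openP 0 d U)
      hU = tyP-open₀ d U hZ ld

    -- Z = elt(w, c), y₀ = atm b, so y₁ = T:  elt(w[c↦b], b)[b↦T] = elt(w[b↦T], c)[c↦T]
    commEltAtm : ∀ R s {w w' w₁ c b T l Y X'} → c ≢ b → c ∉ atomsS T →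
                 TyS [] w l → just (level c) ≡ just (l ℤ.+ + 1) → TyS [] (atm (fr b)) (level c) → TyS [] T (level b) →
                 rank (level b) + rank (level c) ≤ R → sizeS w ≤ s →
                 SigS w c (atm (fr b)) w' → SigS w b T w₁ → SigP (elt w₁ (fr c)) c T Y →
                 SigP (elt w' (fr b)) b T X' → X' ≡ Y
    commEltAtm R s {T = atm (bd n)} c≢b cT hw hv hy₀ (() , _) hR hs E₁ E₃ D₄ D₅
    commEltAtm R s {T = atm (fr p)} c≢b cT hw hv hy₀ hT hR hs E₁ E₃ D₄ D₅ with invEltAtm D₄ | invEltAtm D₅
    ... | _ , E₄ , refl | _ , E₅ , refl =
      cong (λ z → elt z _) (commS R s c≢b cT hw hy₀ hT hR hs E₁ sig-atm-eq E₃ E₄ E₅)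
    commEltAtm R s {w} {w'} {w₁} {c} {b} {st e V} c≢b cT hw hv hy₀ hT hR hs E₁ E₃ D₄ D₅ =
      commEltAtmSt R s c≢b cT hw hv hy₀ hT hR hs E₁ E₃ D₄ D₅
        (pick e ((c ∷ []) ∷ (b ∷ []) ∷ atomsP V ∷ atomsS w₁ ∷ atomsS w' ∷ []))

    -- ... and T = st([f]V): both sides are V[f ↦ -] of w[c↦b][b↦T] = w[b↦T][c↦T]
    commEltAtmSt : ∀ R s {w w' w₁ c b e V l Y X'} → c ≢ b → c ∉ atomsS (st e V) →
                   TyS [] w l → just (level c) ≡ just (l ℤ.+ + 1) → TyS [] (atm (fr b)) (level c) →
                   TyS [] (st e V) (level b) → rank (level b) + rank (level c) ≤ R → sizeS w ≤ s →
                   SigS w c (atm (fr b)) w' → SigS w b (st e V) w₁ → SigP (elt w₁ (fr c)) c (st e V) Y →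
                   SigP (elt w' (fr b)) b (st e V) X' →
                   Fresh e ((c ∷ []) ∷ (b ∷ []) ∷ atomsP V ∷ atomsS w₁ ∷ atomsS w' ∷ []) → X' ≡ Y
    commEltAtmSt R s {w} {w'} {w₁} {c} {b} {e} {V} {l} {Y} c≢b cT hw hv hy₀ hT@(eb , _ , hV) hR hs E₁ E₃ D₄ D₅
                 (f , lf , fc ∷ fb ∷ fV ∷ fw₁ ∷ fw' ∷ [])
      with renameSigEltSt D₄ f lf (∉-singleton fc) fV fw₁ | renameSigEltSt D₅ f lf (∉-singleton fb) fV fw'
    ... | w₁c , E₄ , B₄ | w₂ , E₅ , B₅ =
      detSigP (tyP-open₀ f V hV lf) hw₂ B₅
        (subst (λ z → SigP (openP 0 f V) f z Y) (sym (commS R s c≢b cT hw hy₀ hT hR hs E₁ sig-atm-eq E₃ E₄ E₅)) B₄)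
      where
      hw₂ : TyS [] w₂ (level f)
      hw₂ = subst (TyS [] w₂) (trans (level-pred hv (trans (just-injective (sym (proj₁ hy₀))) eb)) (sym lf))
              (tySigS E₅ (tySigS E₁ hw hy₀) hT)

    -- Z = elt(w, c), y₀ = st([d]U):  X = U[d ↦ w[c↦y₀]] and Y = U[b↦T][d ↦ w[b↦T][c↦y₁]];
    -- commute b past d (one level below c) and use the induction hypothesis on w
    commEltSt : ∀ R s {w w₁ c j U b T X y₁ Y X' l'} → c ≢ b → c ∉ atomsS T →
                TyS [] w l' → just (level c) ≡ just (l' ℤ.+ + 1) → TyS [] (st j U) (level c) → TyS [] T (level b) →
                rank (level b) + rank (level c) ≤ R → sizeS w ≤ s →
                SigP (elt w (fr c)) c (st j U) X → SigS (st j U) b T y₁ → SigS w b T w₁ →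
                SigP (elt w₁ (fr c)) c y₁ Y → SigP X b T X' →
                Fresh j ((c ∷ []) ∷ (b ∷ []) ∷ atomsP U ∷ atomsS w ∷ atomsS T ∷ atomsS w₁ ∷ []) → X' ≡ Y
    commEltSt R s {w} {w₁} {c} {j} {U} {b} {T} {X} {y₁} {Y} c≢b cT hw hv hy₀@(ec , mj , hU) hT hR hs D₁ D₂ E₃ D₄ D₅
              (d , ld , dc ∷ db ∷ dU ∷ dw ∷ dT ∷ dw₁ ∷ [])
      with renameSigEltSt D₁ d ld (∉-singleton dc) dU dw | renameSigSt D₂ d ld (∉-singleton db) dU dT
    ... | w' , E₁ , B₁ | U₁ , E₂ , refl
      with renameSigEltSt D₄ d ld (∉-singleton dc) (∉-close-self 0 d U₁) dw₁
    ...   | w₁c , E₄ , B₄ with totalSigS w' (tySigS E₁ hw hy₀) hT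
    ...     | w₂ , E₅ =
      commP-< R _ (∉-singleton db) dT hUd hw' hT
        (rank-sum-right R {level b} {level c} hR (trans ec (cong (ℤ._+ + 1) (sym ld))) (subst (m ℤ.≤_) (sym ld) mj)) ℕP.≤-refl
        B₁ E₅ E₂
        (subst (λ z → SigP U₁ d z Y) (sym (commS R s c≢b cT hw hy₀ hT hR hs E₁ D₂ E₃ E₄ E₅))
          (subst (λ Z → SigP Z d w₁c Y) (openP-closeP₀ d U₁ (tySigP E₂ hUd hT)) B₄))
        D₅
      where
      hUd : TyP [] (openP 0 d U)
      hUd = tyP-open₀ d U hU ld
      hw' : TyS [] w' (level d)
      hw' = subst (TyS [] w') (trans (level-pred hv ec) (sym ld)) (tySigS E₁ hw hy₀)

    -- Z = elt(w, b), T = st([f]V):  Z₁ = V[f ↦ w[b↦T]] and X' = V[f ↦ w[c↦y₀][b↦T]];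
    -- commute c past f (one level below b), using c # V, and the induction hypothesis on w
    commEltB : ∀ R s {w w' c y₀ b e V y₁ l Z₁ Y X'} → c ≢ b → c ∉ atomsS (st e V) →
               TyS [] w l → just (level b) ≡ just (l ℤ.+ + 1) → TyS [] y₀ (level c) → TyS [] (st e V) (level b) →
               rank (level b) + rank (level c) ≤ R → sizeS w ≤ s →
               SigS w c y₀ w' → SigS y₀ b (st e V) y₁ → SigP (elt w (fr b)) b (st e V) Z₁ → SigP Z₁ c y₁ Y →
               SigP (elt w' (fr b)) b (st e V) X' →
               Fresh e ((c ∷ []) ∷ (b ∷ []) ∷ atomsP V ∷ atomsS w ∷ atomsS w' ∷ atomsS y₁ ∷ []) → X' ≡ Y
    commEltB R s {w} {w'} {c} {y₀} {b} {e} {V} {y₁} {X' = X'} c≢b cT hw hv hy₀ hT@(eb , me , hV) hR hs E₁ D₂ D₃ D₄ D₅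
             (f , lf , fc ∷ fb ∷ fV ∷ fw ∷ fw' ∷ fy₁ ∷ [])
      with renameSigEltSt D₃ f lf (∉-singleton fb) fV fw | renameSigEltSt D₅ f lf (∉-singleton fb) fV fw'
    ... | w₁ , E₃ , B₃ | w₂ , E₅ , B₅ with totalSigS w₁ (tySigS E₃ hw hT) (tySigS D₂ hy₀ hT)
    ...   | w₁c , E₄ =
      sym (commP-< R _ (∉-singleton fc) fy₁ hVf hw₁ hy₁
            (rank-sum-left R {level b} {level c} hR (trans eb (cong (ℤ._+ + 1) (sym lf))) (subst (m ℤ.≤_) (sym lf) me))
            ℕP.≤-refl
            B₃ E₄ (idSigP (openP 0 f V) hVf (∉-open 0 f V cT (λ e → fc (here (sym e)))))
            (subst (λ z → SigP (openP 0 f V) f z X') (commS R s c≢b cT hw hy₀ hT hR hs E₁ D₂ E₃ E₄ E₅) B₅) D₄)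
      where
      hVf : TyP [] (openP 0 f V)
      hVf = tyP-open₀ f V hV lf
      hy₁ : TyS [] y₁ (level c)
      hy₁ = tySigS D₂ hy₀ hT
      hw₁ : TyS [] w₁ (level f)
      hw₁ = subst (TyS [] w₁) (trans (level-pred hv eb) (sym lf)) (tySigS E₃ hw hT)

    commL : ∀ R s {Xs c y₀ b T Xs' y₁ Zs₁ Ys Xs''} → c ≢ b → c ∉ atomsS T →
            TyL [] Xs → TyS [] y₀ (level c) → TyS [] T (level b) →
            rank (level b) + rank (level c) ≤ R → sizeL Xs ≤ s →
            SigL Xs c y₀ Xs' → SigS y₀ b T y₁ → SigL Xs b T Zs₁ → SigL Zs₁ c y₁ Ys → SigL Xs' b T Xs'' →
            Xs'' ≡ Ys
    commL R s c≢b cT hZ hy₀ hT hR hs sigL-[] D₂ sigL-[] sigL-[] sigL-[] = refl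
    commL R s {X ∷ Xs} c≢b cT (h₁ , h₂) hy₀ hT hR hs
          (sigL-∷ A₁ B₁) D₂ (sigL-∷ A₃ B₃) (sigL-∷ A₄ B₄) (sigL-∷ A₅ B₅) =
      cong₂ _∷_ (commP R s c≢b cT h₁ hy₀ hT hR (ℕP.m+n≤o⇒m≤o (sizeP X) hs) A₁ D₂ A₃ A₄ A₅)
                (commL R s c≢b cT h₂ hy₀ hT hR (ℕP.m+n≤o⇒n≤o (sizeP X) hs) B₁ D₂ B₃ B₄ B₅)

    commS : ∀ R s {z c y₀ b T x y₁ z₁ y x' i} → c ≢ b → c ∉ atomsS T →
            TyS [] z i → TyS [] y₀ (level c) → TyS [] T (level b) →
            rank (level b) + rank (level c) ≤ R → sizeS z ≤ s →
            SigS z c y₀ x → SigS y₀ b T y₁ → SigS z b T z₁ → SigS z₁ c y₁ y → SigS x b T x' → x' ≡ y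
    -- z = atm c: both sides are y₀[b ↦ T]
    commS R s c≢b cT hz hy₀ hT hR hs sig-atm-eq D₂ D₃ D₄ D₅ with invAtmOther D₃ c≢b
    ... | refl with invAtmSelf D₄
    ...   | refl = detSigS hy₀ hT D₅ D₂
    -- z = atm b: both sides are T, since c # T
    commS R s {T = T} c≢b cT hz hy₀ hT hR hs (sig-atm-neq v≢c) D₂ sig-atm-eq D₄ D₅ with invAtmSelf D₅
    ... | refl = sym (detSigS hT (tySigS D₂ hy₀ hT) D₄ (idSigS T hT cT))
    commS R s c≢b cT hz hy₀ hT hR hs (sig-atm-neq v≢c) D₂ (sig-atm-neq v≢b) D₄ D₅
      with invAtmOther D₄ v≢c | invAtmOther D₅ v≢b
    ... | refl | refl = refl
    commS R (suc s) {st j U} {c} {y₀} {b} {T} {y₁ = y₁} c≢b cT hz hy₀ hT hR (s≤s hs)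
          D₁@(sig-st _ _ _ _ _ _) D₂ D₃ D₄ D₅ =
      commSt R s c≢b cT hz hy₀ hT hR hs D₁ D₂ D₃ D₄ D₅
        (pick j ((c ∷ []) ∷ (b ∷ []) ∷ atomsP U ∷ atomsS y₀ ∷ atomsS T ∷ atomsS y₁ ∷ []))

    commSt : ∀ R s {j U c y₀ b T X y₁ Z₁ Y X' i} → c ≢ b → c ∉ atomsS T →
             TyS [] (st j U) i → TyS [] y₀ (level c) → TyS [] T (level b) →
             rank (level b) + rank (level c) ≤ R → sizeP U ≤ s →
             SigS (st j U) c y₀ X → SigS y₀ b T y₁ → SigS (st j U) b T Z₁ → SigS Z₁ c y₁ Y → SigS X b T X' →
             Fresh j ((c ∷ []) ∷ (b ∷ []) ∷ atomsP U ∷ atomsS y₀ ∷ atomsS T ∷ atomsS y₁ ∷ []) → X' ≡ Y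
    commSt R s {j} {U} {c} {y₀} {b} {T} {y₁ = y₁} c≢b cT (_ , _ , hZ) hy₀ hT hR hs D₁ D₂ D₃ D₄ D₅
           (d , ld , dc ∷ db ∷ dU ∷ dy₀ ∷ dT ∷ dy₁ ∷ [])
      with renameSigSt D₁ d ld (∉-singleton dc) dU dy₀ | renameSigSt D₃ d ld (∉-singleton db) dU dT
    ... | W₁ , E₁ , refl | W₃ , E₃ , refl
      with renameSigSt D₄ d ld (∉-singleton dc) (∉-close-self 0 d W₃) dy₁
         | renameSigSt D₅ d ld (∉-singleton db) (∉-close-self 0 d W₁) dT
    ...   | W₄ , E₄ , refl | W₅ , E₅ , refl =
      cong (λ W → st j (closeP 0 d W))
        (commP R s c≢b cT hU hy₀ hT hR (sizeP-open≤ d U hs) E₁ D₂ E₃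
          (subst (λ Z → SigP Z c y₁ W₄) (openP-closeP₀ d W₃ (tySigP E₃ hU hT)) E₄)
          (subst (λ Z → SigP Z b T W₅) (openP-closeP₀ d W₁ (tySigP E₁ hU hy₀)) E₅))
      where
      hU : TyP [] (openP 0 d U)
      hU = tyP-open₀ d U hZ ld

  tyMemb : ∀ {y x W j} → Memb y x W → TyS [] y j → TyS [] x (j ℤ.+ + 1) → TyP [] W
  tyMemb {j = j} memb-atm hy (e , _) = j , hy , e
  tyMemb {y} (memb-st {X = X} b lb _ _ D) hy (ej , _ , hX) =
    tySigP D (tyP-open₀ b X hX lb) (subst (TyS [] y) (trans (∙-cancelʳ (+ 1) _ _ ej) (sym lb)) hy)

  detMemb : ∀ {y x W₁ W₂ j} → Memb y x W₁ → Memb y x W₂ → TyS [] y j → TyS [] x (j ℤ.+ + 1) → W₁ ≡ W₂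
  detMemb memb-atm memb-atm hy hx = refl
  detMemb {y} {st i X} M₁@(memb-st _ _ _ _ _) M₂ hy (ej , _ , hX) with pick i (atomsP X ∷ atomsS y ∷ [])
  ... | d , ld , dX ∷ dy ∷ [] =
    detSigP (tyP-open₀ d X hX ld) (subst (TyS [] y) (trans (∙-cancelʳ (+ 1) _ _ ej) (sym ld)) hy)
      (renameMemb M₁ d ld dX dy) (renameMemb M₂ d ld dX dy)

  mutual
    tyIntF : ∀ {φ X} → IntF φ X → Stratified φ → LevelsAboveF m φ → TyP [] X
    tyIntF int-⊥ h b = tt
    tyIntF (int-¬ D) h b = tyIntF D h b
    tyIntF (int-∧ D E) (h₁ , h₂) (b₁ , b₂) = tyIntF D h₁ b₁ , tyIntF E h₂ b₂ , tt
    tyIntF (int-∀ {i} {φ} {X} a la _ D) h (mi , bφ) =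
      subst (λ k → TyP (k ∷ []) (closeP 0 a X)) la
        (tyP-close₀ a X (tyIntF D (stratF-open [] i a φ h la)
          (levelsAboveF-open m 0 a φ bφ (subst (m ℤ.≤_) (sym la) mi))))
    tyIntF (int-∈ Dt Ds M) (h₁ , h₂ , j , e₁ , e₂) (b₁ , b₂) = tyMemb M (tyIntT Dt h₁ b₁ e₁) (tyIntT Ds h₂ b₂ e₂)

    tyIntT : ∀ {t x l} → IntT t x → StratifiedT t → LevelsAboveT m t → lvT [] t ≡ just l → TyS [] x l
    tyIntT int-var h b e = e , subst (m ℤ.≤_) (just-injective e) b
    tyIntT (int-cmp {j} {φ} {X} a la _ D) h (mj , bφ) e =
      sym (just-injective e) , mj ,
      subst (λ k → TyP (k ∷ []) (closeP 0 a X)) la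
        (tyP-close₀ a X (tyIntF D (stratF-open [] j a φ h la)
          (levelsAboveF-open m 0 a φ bφ (subst (m ℤ.≤_) (sym la) mj))))

  mutual
    detIntF : ∀ s {φ X₁ X₂} → sizeF φ ≤ s → Stratified φ → LevelsAboveF m φ →
              IntF φ X₁ → IntF φ X₂ → X₁ ≡ X₂
    detIntF s hs h b int-⊥ int-⊥ = refl
    detIntF (suc s) (s≤s hs) h b (int-¬ D₁) (int-¬ D₂) = cong neg (detIntF s hs h b D₁ D₂)
    detIntF (suc s) {φ ∧f ψ} (s≤s hs) (h₁ , h₂) (b₁ , b₂) (int-∧ D₁ E₁) (int-∧ D₂ E₂) =
      cong₂ (λ X Y → and (X ∷ Y ∷ [])) (detIntF s (ℕP.m+n≤o⇒m≤o (sizeF φ) hs) h₁ b₁ D₁ D₂)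
                                        (detIntF s (ℕP.m+n≤o⇒n≤o (sizeF φ) hs) h₂ b₂ E₁ E₂)
    detIntF (suc s) {∀f i φ} {X₁} {X₂} (s≤s hs) h (mi , bφ) D₁ D₂
      with pick i (atomsF φ ∷ atomsP X₁ ∷ atomsP X₂ ∷ [])
    ... | d , ld , dφ ∷ dX₁ ∷ dX₂ ∷ [] with renameIntAll D₁ d ld dφ dX₁ | renameIntAll D₂ d ld dφ dX₂
    ...   | Y₁ , E₁ , refl | Y₂ , E₂ , refl =
      cong (λ Z → all i (closeP 0 d Z))
        (detIntF s (sizeF-open≤ d φ hs) (stratF-open [] i d φ h ld)
          (levelsAboveF-open m 0 d φ bφ (subst (m ℤ.≤_) (sym ld) mi)) E₁ E₂)
    detIntF (suc s) {t ∈f u} (s≤s hs) (h₁ , h₂ , j , e₁ , e₂) (b₁ , b₂) (int-∈ Dt₁ Du₁ M₁) (int-∈ Dt₂ Du₂ M₂)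
      with detIntT s (ℕP.m+n≤o⇒m≤o (sizeT t) hs) h₁ b₁ Dt₁ Dt₂
         | detIntT s (ℕP.m+n≤o⇒n≤o (sizeT t) hs) h₂ b₂ Du₁ Du₂
    ... | refl | refl = detMemb M₁ M₂ (tyIntT Dt₁ h₁ b₁ e₁) (tyIntT Du₁ h₂ b₂ e₂)

    detIntT : ∀ s {t x₁ x₂} → sizeT t ≤ s → StratifiedT t → LevelsAboveT m t →
              IntT t x₁ → IntT t x₂ → x₁ ≡ x₂
    detIntT s hs h b int-var int-var = refl
    detIntT (suc s) {cmp j φ} {x₁} {x₂} (s≤s hs) h (mj , bφ) D₁ D₂
      with pick j (atomsF φ ∷ atomsS x₁ ∷ atomsS x₂ ∷ [])
    ... | d , ld , dφ ∷ dx₁ ∷ dx₂ ∷ [] with renameIntCmp D₁ d ld dφ dx₁ | renameIntCmp D₂ d ld dφ dx₂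
    ...   | Y₁ , E₁ , refl | Y₂ , E₂ , refl =
      cong (λ Z → st j (closeP 0 d Z))
        (detIntF s (sizeF-open≤ d φ hs) (stratF-open [] j d φ h ld)
          (levelsAboveF-open m 0 d φ bφ (subst (m ℤ.≤_) (sym ld) mj)) E₁ E₂)

module SubstitutionLemma (m : ℤ) (b : Atom) (t : Tm) (strat-t : StratifiedT t) (above-t : LevelsAboveT m t)
                         (level-t : lvT [] t ≡ just (level b)) where
  open Floor m

  ty-t : ∀ {T} → IntT t T → TyS [] T (level b)
  ty-t It = tyIntT It strat-t above-t level-t

  det-t : ∀ {T S} → IntT t T → IntT t S → T ≡ S
  det-t = detIntT _ ℕP.≤-refl strat-t above-t

  t-closed : ∀ k c → openT k c t ≡ t
  t-closed k c = openT-out-of-scope [] k c t strat-t z≤n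

  intVar : ∀ {c x} → IntT (var (fr c)) x → x ≡ atm (fr c)
  intVar int-var = refl

  membAtm : ∀ {y c W} → Memb y (atm (fr c)) W → W ≡ elt y (fr c)
  membAtm memb-atm = refl

  mutual
    substF-sound : ∀ s φ → sizeF φ ≤ s → Stratified φ → LevelsAboveF m φ →
                   ∀ {X T Y} → IntF φ X → IntT t T → IntF (substF b t φ) Y → SigP X b T Y
    substF-sound s ⊥f hs h ab int-⊥ It int-⊥ = sig-neg (sig-and sigL-[])
    substF-sound (suc s) (¬f φ) (s≤s hs) h ab (int-¬ D) It (int-¬ E) = sig-neg (substF-sound s φ hs h ab D It E)
    substF-sound (suc s) (φ ∧f ψ) (s≤s hs) (h₁ , h₂) (ab₁ , ab₂) (int-∧ D₁ D₂) It (int-∧ E₁ E₂) =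
      sig-and (sigL-∷ (substF-sound s φ (ℕP.m+n≤o⇒m≤o (sizeF φ) hs) h₁ ab₁ D₁ It E₁)
              (sigL-∷ (substF-sound s ψ (ℕP.m+n≤o⇒n≤o (sizeF φ) hs) h₂ ab₂ D₂ It E₂) sigL-[]))
    substF-sound (suc s) (∀f i φ) (s≤s hs) h ab {X} {T} {Y} D It E =
      substAll s i φ hs h ab D It E
        (pick i ((b ∷ []) ∷ atomsF φ ∷ atomsF (substF b t φ) ∷ atomsP X ∷ atomsP Y ∷ atomsS T ∷ []))
    substF-sound (suc s) (t' ∈f var (bd n)) (s≤s hs) (_ , (_ , ()) , _) ab D It E
    substF-sound (suc s) (t' ∈f var (fr c)) (s≤s hs) (h₁ , _) (ab₁ , _) (int-∈ Dt Ds M) It (int-∈ Et Es M')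
      with substT-sound s t' (ℕP.m+n≤o⇒m≤o (sizeT t') hs) h₁ ab₁ Dt It Et | c ≟A b
    ... | IHt | no c≢b with intVar Ds | intVar Es
    ...   | refl | refl with membAtm M | membAtm M'
    ...     | refl | refl = sig-elt-oth c≢b IHt
    -- t' ∈ b: ⟦t' ∈ b⟧[b ↦ ⟦t⟧] = ⟦t'⟧[b ↦ ⟦t⟧] ∈̃ ⟦t⟧
    substF-sound (suc s) (t' ∈f var (fr c)) (s≤s hs) (h₁ , _) (ab₁ , _) (int-∈ Dt Ds M) It (int-∈ Et Es M')
        | IHt | yes refl with intVar Ds | det-t It Es
    ...   | refl | refl with membAtm M
    ...     | refl = substMembB IHt M'
    -- t' ∈ {a | ψ}: the commutation lemma
    substF-sound (suc s) (t' ∈f cmp j ψ) (s≤s hs) (h₁ , h₂ , _ , e₁ , e₂) (ab₁ , ab₂) {X} {T}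
          (int-∈ {y = y} Dt Ds@(int-cmp {X = X₀} a _ _ _) M) It (int-∈ {y = y₁} Et Es M') =
      substMembCmp (substT-sound s t' (ℕP.m+n≤o⇒m≤o (sizeT t') hs) h₁ ab₁ Dt It Et)
                   (substT-sound s (cmp j ψ) (ℕP.m+n≤o⇒n≤o (sizeT t') hs) h₂ ab₂ Ds It Es)
                   (tyIntT Dt h₁ ab₁ e₁) (tyIntT Ds h₂ ab₂ e₂) (ty-t It) M M'
                   (pick j ((b ∷ []) ∷ atomsP (closeP 0 a X₀) ∷ atomsS y ∷ atomsS T ∷ atomsS y₁ ∷ []))

    substMembB : ∀ {y y₁ T Y} → SigS y b T y₁ → Memb y₁ T Y → SigP (elt y (fr b)) b T Y
    substMembB IHt memb-atm = sig-elt-atm IHt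
    substMembB {y} {y₁} {st j X'} IHt M'@(memb-st _ _ _ _ _)
      with pick j ((b ∷ []) ∷ atomsP X' ∷ atomsS y ∷ atomsS y₁ ∷ [])
    ... | d , ld , db ∷ dX ∷ dy ∷ dy₁ ∷ [] = sig-elt-st d ld (∉-singleton db) dX dy IHt (renameMemb M' d ld dX dy₁)

    -- (y ∈̃ st([d]X₀))[b ↦ T] = X₀[d ↦ y][b ↦ T] = X₀[b ↦ T][d ↦ y[b ↦ T]] = y₁ ∈̃ x₁
    substMembCmp : ∀ {y y₁ j X₀ x₁ T X Y j'} → SigS y b T y₁ → SigS (st j X₀) b T x₁ →
                   TyS [] y j' → TyS [] (st j X₀) (j' ℤ.+ + 1) → TyS [] T (level b) →
                   Memb y (st j X₀) X → Memb y₁ x₁ Y →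
                   Fresh j ((b ∷ []) ∷ atomsP X₀ ∷ atomsS y ∷ atomsS T ∷ atomsS y₁ ∷ []) → SigP X b T Y
    substMembCmp {y} {y₁} {j} {X₀} {T = T} {X} {Y} IHt IHs hy hx@(ej , _ , hX₀) hT M M'
                 (d , ld , db ∷ dX₀ ∷ dy ∷ dT ∷ dy₁ ∷ [])
      with renameSigSt IHs d ld (∉-singleton db) dX₀ dT
    ... | U₁ , E₃ , refl with totalSigP X (tyMemb M hy hx) hT
    ...   | X' , D₅ =
      subst (SigP X b T)
        (commP _ (sizeP (openP 0 d X₀)) (∉-singleton db) dT hX₀d hyd hT ℕP.≤-refl ℕP.≤-refl E₁ IHt E₃ E₄ D₅) D₅
      where
      hX₀d : TyP [] (openP 0 d X₀)
      hX₀d = tyP-open₀ d X₀ hX₀ ld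
      hyd : TyS [] y (level d)
      hyd = subst (TyS [] y) (trans (∙-cancelʳ (+ 1) _ _ ej) (sym ld)) hy
      E₁ : SigP (openP 0 d X₀) d y X
      E₁ = renameMemb M d ld dX₀ dy
      E₄ : SigP U₁ d y₁ Y
      E₄ = subst (λ Z → SigP Z d y₁ Y) (openP-closeP₀ d U₁ (tySigP E₃ hX₀d hT))
             (renameMemb M' d ld (∉-close-self 0 d U₁) dy₁)

    substAll : ∀ s i φ → sizeF φ ≤ s → StratF (i ∷ []) φ → LevelsAboveF m (∀f i φ) → ∀ {X T Y} →
               IntF (∀f i φ) X → IntT t T → IntF (∀f i (substF b t φ)) Y →
               Fresh i ((b ∷ []) ∷ atomsF φ ∷ atomsF (substF b t φ) ∷ atomsP X ∷ atomsP Y ∷ atomsS T ∷ []) →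
               SigP X b T Y
    substAll s i φ hs h (mi , abφ) {T = T} D It E (d , ld , db ∷ dφ ∷ dsφ ∷ dX ∷ dY ∷ dT ∷ [])
      with renameIntAll D d ld dφ dX | renameIntAll E d ld dsφ dY
    ... | Xd , IX , refl | Yd , IY , refl =
      sig-all d ld (∉-singleton db) (∉-close-self 0 d Xd) dT
        (subst (λ Z → SigP Z b T Yd) (sym (openP-closeP₀ d Xd (tyIntF IX hφd abφd)))
          (substF-sound s (openF 0 d φ) (sizeF-open≤ d φ hs) hφd abφd IX It
            (subst (λ ψ → IntF ψ Yd) (openF-subst b t t-closed 0 d φ (∉-singleton db)) IY)))
      where
      hφd : Stratified (openF 0 d φ)
      hφd = stratF-open [] i d φ h ld
      abφd : LevelsAboveF m (openF 0 d φ)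
      abφd = levelsAboveF-open m 0 d φ abφ (subst (m ℤ.≤_) (sym ld) mi)

    substT-sound : ∀ s r → sizeT r ≤ s → StratifiedT r → LevelsAboveT m r →
                   ∀ {R T S} → IntT r R → IntT t T → IntT (substT b t r) S → SigS R b T S
    substT-sound s (var (bd n)) hs (_ , ()) ab D It E
    substT-sound s (var (fr c)) hs h ab int-var It E with c ≟A b
    ... | yes refl with det-t It E
    ...   | refl = sig-atm-eq
    substT-sound s (var (fr c)) hs h ab int-var It E | no c≢b with intVar E
    ...   | refl = sig-atm-neq c≢b
    substT-sound (suc s) (cmp j ψ) (s≤s hs) h ab {R} {T} {S} D It E =
      substCmp s j ψ hs h ab D It E
        (pick j ((b ∷ []) ∷ atomsF ψ ∷ atomsF (substF b t ψ) ∷ atomsS R ∷ atomsS S ∷ atomsS T ∷ []))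

    substCmp : ∀ s j ψ → sizeF ψ ≤ s → StratF (j ∷ []) ψ → LevelsAboveT m (cmp j ψ) → ∀ {R T S} →
               IntT (cmp j ψ) R → IntT t T → IntT (cmp j (substF b t ψ)) S →
               Fresh j ((b ∷ []) ∷ atomsF ψ ∷ atomsF (substF b t ψ) ∷ atomsS R ∷ atomsS S ∷ atomsS T ∷ []) →
               SigS R b T S
    substCmp s j ψ hs h (mj , abψ) {T = T} D It E (d , ld , db ∷ dψ ∷ dsψ ∷ dR ∷ dS ∷ dT ∷ [])
      with renameIntCmp D d ld dψ dR | renameIntCmp E d ld dsψ dS
    ... | Xd , IX , refl | Yd , IY , refl =
      sig-st d ld (∉-singleton db) (∉-close-self 0 d Xd) dT
        (subst (λ Z → SigP Z b T Yd) (sym (openP-closeP₀ d Xd (tyIntF IX hψd abψd)))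
          (substF-sound s (openF 0 d ψ) (sizeF-open≤ d ψ hs) hψd abψd IX It
            (subst (λ φ → IntF φ Yd) (openF-subst b t t-closed 0 d ψ (∉-singleton db)) IY)))
      where
      hψd : Stratified (openF 0 d ψ)
      hψd = stratF-open [] j d ψ h ld
      abψd : LevelsAboveF m (openF 0 d ψ)
      abψd = levelsAboveF-open m 0 d ψ abψ (subst (m ℤ.≤_) (sym ld) mj)

-- Proposition 5.12.  Take the floor m below every level occurring in φ, t and r.
proposition5p12 : (φ : Fm) (t r : Tm) (b : Atom) →
    Stratified φ → StratifiedT t → StratifiedT r →
    lvT [] t ≡ just (level b) →
    (∀ {X T Y} → IntF φ X → IntT t T → IntF (substF b t φ) Y → SigP X b T Y)
    × (∀ {R T S} → IntT r R → IntT t T → IntT (substT b t r) S → SigS R b T S)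
proposition5p12 φ t r b hφ ht hr lt =
  substF-sound (sizeF φ) φ ℕP.≤-refl hφ (levelsAboveF m φ (≤-⊓ˡ (≤-⊓ˡ ℤP.≤-refl))) ,
  substT-sound (sizeT r) r ℕP.≤-refl hr (levelsAboveT m r (≤-⊓ʳ ℤP.≤-refl))
  where
  m : ℤ
  m = (floorF φ ℤ.⊓ floorT t) ℤ.⊓ floorT r
  open SubstitutionLemma m b t ht (levelsAboveT m t (≤-⊓ʳ (≤-⊓ˡ ℤP.≤-refl))) lt
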